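{- Let $R=\{(0,0),(0,1),(1,0),(1,1),(1,2),(1,3),(2,1),(2,2),(2,3),(3,1),(3,2)\}$. Then the mesh patterns $(123,R)$ and $(132,R)$ are equidistributed, i.e. $(123,R)\sim_d(132,R)$.
   Context: $S_n$ denotes the set of permutations of $[n]=\{1,\dots,n\}$, written in one-line notation $\pi=\pi_1\cdots\pi_n$. A mesh pattern of length $k$ is a pair $(\tau,R)$ with $\tau\in S_k$ and $R\subseteq\{0,1,\dots,k\}^2$; an element $(a,b)\in R$ is a shaded box (the unit square $[a,a+1]\times[b,b+1]$ in the diagram of $\tau$ with points $(i,\tau_i)$). An occurrence of $(\tau,R)$ in $\pi\in S_n$ is a choice of indices $i_1<\dots<i_k$ such that $\pi_{i_1}\cdots\pi_{i_k}$ is order-isomorphic to $\tau$ and, with $i_0=0$, $i_{k+1}=n+1$, and $v_1<\dots<v_k$ the values $\pi_{i_1},\dots,\pi_{i_k}$ sorted increasingly, $v_0=0$, $v_{k+1}=n+1$, for every $(a,b)\in R$ there is no index $m$ with $i_a<m<i_{a+1}$ and $v_b<\pi_m<v_{b+1}$. Two mesh patterns $p,q$ are equidistributed, $p\sim_d q$, if for all $n,\ell\ge 0$ the number of $\pi\in S_n$ with exactly $\ell$ occurrences of $p$ equals the number of $\pi\in S_n$ with exactly $\ell$ occurrences of $q$. -}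

module Defs where

open import Data.Bool using (Bool; true; false; _∧_; not; if_then_else_)
open import Data.Nat using (ℕ; zero; suc; _+_; _∸_; _<ᵇ_; _≡ᵇ_)
open import Data.List using (List; []; _∷_; [_]; _++_; map; length; upTo; concatMap; filterᵇ)
open import Data.Bool.ListAction using (all; any)
open import Data.Product using (_×_; _,_)
open import Relation.Binary.PropositionalEquality using (_≡_)

-- Permutations are written in one-line notation as lists of naturals.
-- Positions and values are 1-based as in the paper.

range1 : ℕ → List ℕ
range1 n = map suc (upTo n)

-- i-th entry (0-based) of a list, with default 0 outside the range
nth : List ℕ → ℕ → ℕ
nth []       _       = 0
nth (x ∷ xs) zero    = x
nth (x ∷ xs) (suc i) = nth xs i

_==ᴮ_ : Bool → Bool → Bool
true  ==ᴮ b = b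
false ==ᴮ b = not b

words : ℕ → ℕ → List (List ℕ)
words zero    n = [ [] ]
words (suc k) n = concatMap (λ w → map (λ v → v ∷ w) (range1 n)) (words k n)

countOf : ℕ → List ℕ → ℕ
countOf v []       = 0
countOf v (x ∷ xs) = (if v ≡ᵇ x then 1 else 0) + countOf v xs

-- a word of length n over [1..n] is a permutation iff each of 1..n occurs exactly once
isPermᵇ : ℕ → List ℕ → Bool
isPermᵇ n w = all (λ v → countOf v w ≡ᵇ 1) (range1 n)

S : ℕ → List (List ℕ)
S n = filterᵇ (isPermᵇ n) (words n n)

choose : ℕ → List ℕ → List (List ℕ)
choose zero    xs       = [ [] ]
choose (suc k) []       = []
choose (suc k) (x ∷ xs) = map (x ∷_) (choose k xs) ++ choose (suc k) xs

insert : ℕ → List ℕ → List ℕ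
insert x []       = [ x ]
insert x (y ∷ ys) = if x <ᵇ y then x ∷ y ∷ ys else y ∷ insert x ys

sort : List ℕ → List ℕ
sort []       = []
sort (x ∷ xs) = insert x (sort xs)

record MeshPattern : Set where
  constructor mesh
  field
    τ : List ℕ
    R : List (ℕ × ℕ)
open MeshPattern public

orderIsoᵇ : List ℕ → List ℕ → Bool
orderIsoᵇ xs ys =
  (length xs ≡ᵇ length ys) ∧
  all (λ a → all (λ b → (nth xs a <ᵇ nth xs b) ==ᴮ (nth ys a <ᵇ nth ys b)) (upTo (length xs)))
      (upTo (length xs))

between : ℕ → ℕ → ℕ → Bool
between lo x hi = (lo <ᵇ x) ∧ (x <ᵇ hi)

-- I = (i_0 = 0, i_1, ..., i_k, i_{k+1} = n+1),
-- V = (v_0 = 0, v_1 < ... < v_k, v_{k+1} = n+1)  (the values π_{i_j} sorted);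
-- the box (a,b) ∈ R is empty iff there is no m with I_a < m < I_{a+1} and V_b < π_m < V_{b+1}.
isOccᵇ : MeshPattern → List ℕ → List ℕ → Bool
isOccᵇ p π is =
  orderIsoᵇ vals (τ p) ∧
  all (λ { (a , b) →
        not (any (λ m → between (nth I a) m (nth I (suc a)) ∧
                         between (nth V b) (nth π (m ∸ 1)) (nth V (suc b)))
                 (range1 n)) })
      (R p)
  where
  n    = length π
  vals = map (λ i → nth π (i ∸ 1)) is
  I    = 0 ∷ is ++ [ suc n ]
  V    = 0 ∷ sort vals ++ [ suc n ]

occ : MeshPattern → List ℕ → ℕ
occ p π = length (filterᵇ (isOccᵇ p π) (choose (length (τ p)) (range1 (length π))))

numWith : MeshPattern → ℕ → ℕ → ℕ
numWith p n ℓ = length (filterᵇ (λ π → occ p π ≡ᵇ ℓ) (S n))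

_∼d_ : MeshPattern → MeshPattern → Set
p ∼d q = ∀ (n ℓ : ℕ) → numWith p n ℓ ≡ numWith q n ℓ


R₀ : List (ℕ × ℕ)
R₀ = (0 , 0) ∷ (0 , 1) ∷ (1 , 0) ∷ (1 , 1) ∷ (1 , 2) ∷ (1 , 3) ∷
     (2 , 1) ∷ (2 , 2) ∷ (2 , 3) ∷ (3 , 1) ∷ (3 , 2) ∷ []

module Submission where

open import Defs
open import Data.Bool using (Bool; true; false; T; not; _∧_; _∨_; if_then_else_)
open import Data.Bool.Properties using (T?; T-≡; T-∧)
open import Data.Bool.ListAction using (all; any)
open import Data.Unit using (tt)
open import Data.Nat using (ℕ; zero; suc; pred; _+_; _∸_; _≤_; _<_; z≤n; s≤s; _<ᵇ_; _≤ᵇ_; _≡ᵇ_)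
open import Data.Nat.Properties
  using (≤-refl; ≤-trans; <-trans; <⇒≤; <⇒≢; >⇒≢; <-irrefl; <-asym; ≤-<-trans; <-≤-trans; n<1+n; n≤1+n; <-cmp;
         ≤∧≢⇒<; ≮⇒≥; _≟_; m≤n⇒m<n∨m≡n; m≤n+m; +-assoc; +-comm; +-cancelʳ-≡; +-identityʳ; +-suc;
         ≡ᵇ⇒≡; ≡⇒≡ᵇ; <ᵇ⇒<; <⇒<ᵇ; ≤ᵇ⇒≤; ≤⇒≤ᵇ; n≮n; ≤-pred)
open import Data.List using (List; []; _∷_; [_]; _++_; map; length; filterᵇ; upTo; concatMap; cartesianProductWith)
open import Data.List.Properties using (length-map; ∷-injective; ∷-injectiveˡ; ∷-injectiveʳ)
open import Data.List.Membership.Propositional using (_∈_; find; lose)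
open import Data.List.Membership.Propositional.Properties
  using (∈-map⁺; ∈-map⁻; ∈-upTo⁺; ∈-upTo⁻; ∈-filter⁺; ∈-filter⁻; ∈-++⁺ˡ; ∈-++⁺ʳ; ∈-++⁻;
         ∈-cartesianProductWith⁺; ∈-cartesianProductWith⁻)
open import Data.List.Membership.Propositional.Properties.WithK using (unique∧set⇒bag)
open import Data.List.Relation.Unary.All as All using (All; []; _∷_)
import Data.List.Relation.Unary.All.Properties as All
open import Data.List.Relation.Unary.Any using (here; there)
import Data.List.Relation.Unary.Any.Properties as Any
open import Data.List.Relation.Unary.AllPairs as AllPairs using (AllPairs; []; _∷_)
import Data.List.Relation.Unary.AllPairs.Properties as AllPairs
open import Data.List.Relation.Unary.Unique.Propositional using (Unique)
import Data.List.Relation.Unary.Unique.Propositional.Properties as Unique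
open import Data.List.Relation.Binary.BagAndSetEquality using (∼bag⇒↭)
open import Data.List.Relation.Binary.Permutation.Propositional.Properties using (↭-length)
open import Data.Product using (_×_; _,_; proj₁; proj₂; ∃-syntax)
open import Data.Sum using (_⊎_; inj₁; inj₂)
import Data.Sum as Sum
open import Data.Empty using (⊥; ⊥-elim)
open import Function using (_∘_; _⇔_; mk⇔; Equivalence; case_of_)
import Function.Properties.Equivalence as ⇔
open import Relation.Nullary using (¬_; yes; no)
open import Relation.Binary.Definitions using (tri<; tri≈; tri>)
open import Relation.Binary.PropositionalEquality
  using (_≡_; _≢_; refl; sym; trans; cong; cong₂; subst; subst₂; ≢-sym; module ≡-Reasoning)

-- In both patterns the shading forces the second position of an occurrence to be i + 1, and what
-- remains is symmetric in the two larger entries: positions i, i + 1, j carry an occurrence of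
-- (123,R) or of (132,R) iff π_i < π_{i+1}, π_j, every entry left of i exceeds min(π_{i+1}, π_j),
-- every entry strictly between i + 1 and j is below π_i, and no entry right of j lies strictly
-- between π_i and max(π_{i+1}, π_j).  Hence j is the first position after i + 1 holding an entry
-- above π_i, so each i carries at most one occurrence of either pattern.  Exchanging π_{i+1} and π_j
-- turns an occurrence of one pattern at i into one of the other, and a case analysis shows that it
-- does not change which pattern, if any, occurs at any other position.  Each exchange is an
-- involution of S_n, so doing them for i = 1, …, n in turn is a bijection of S_n that carries the
-- occurrences of (123,R) onto those of (132,R).

-- Lists without repetition

unique-length : {A : Set} {xs ys : List A} → Unique xs → Unique ys →
                (∀ {z} → z ∈ xs ⇔ z ∈ ys) → length xs ≡ length ys
unique-length xs! ys! xs⇔ys = ↭-length (∼bag⇒↭ (unique∧set⇒bag xs! ys! xs⇔ys))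

map-unique : {A B : Set} (f : A → B) {xs : List A} →
             (∀ {x y} → x ∈ xs → y ∈ xs → f x ≡ f y → x ≡ y) → Unique xs → Unique (map f xs)
map-unique f {[]}     _   []          = []
map-unique f {x ∷ xs} inj (x∉xs ∷ xs!) =
  All.map⁺ (All.tabulate λ y∈xs fx≡fy → All.lookup x∉xs y∈xs (inj (here refl) (there y∈xs) fx≡fy))
  ∷ map-unique f (λ x∈ y∈ → inj (there x∈) (there y∈)) xs!

filterᵇ-unique : {A : Set} (p : A → Bool) {xs : List A} → Unique xs → Unique (filterᵇ p xs)
filterᵇ-unique p = Unique.filter⁺ (T? ∘ p)

length-filterᵇ-cong : {A : Set} (p q : A → Bool) {xs : List A} → (∀ {x} → x ∈ xs → T (p x) ⇔ T (q x)) →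
                      length (filterᵇ p xs) ≡ length (filterᵇ q xs)
length-filterᵇ-cong p q {[]}     _   = refl
length-filterᵇ-cong p q {x ∷ xs} p⇔q with p x in px | q x in qx
... | true  | true  = cong suc (length-filterᵇ-cong p q (p⇔q ∘ there))
... | false | false = length-filterᵇ-cong p q (p⇔q ∘ there)
... | true  | false = ⊥-elim (subst T qx (Equivalence.to (p⇔q (here refl)) (subst T (sym px) tt)))
... | false | true  = ⊥-elim (subst T px (Equivalence.from (p⇔q (here refl)) (subst T (sym qx) tt)))

length-filterᵇ-bijection :
  {A : Set} {xs : List A} (p q : A → Bool) {F G : A → A} → Unique xs →
  (∀ {x} → x ∈ xs → F x ∈ xs) → (∀ {x} → x ∈ xs → G x ∈ xs) →
  (∀ {x} → x ∈ xs → G (F x) ≡ x) → (∀ {x} → x ∈ xs → F (G x) ≡ x) →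
  (∀ {x} → x ∈ xs → q (F x) ≡ p x) →
  length (filterᵇ p xs) ≡ length (filterᵇ q xs)
length-filterᵇ-bijection {xs = xs} p q {F} {G} xs! F∈ G∈ GF FG q∘F≡p =
  trans (sym (length-map F (filterᵇ p xs)))
        (unique-length (map-unique F injective (filterᵇ-unique p xs!)) (filterᵇ-unique q xs!) (mk⇔ to from))
  where
  injective : ∀ {x y} → x ∈ filterᵇ p xs → y ∈ filterᵇ p xs → F x ≡ F y → x ≡ y
  injective x∈ y∈ Fx≡Fy = trans (sym (GF (proj₁ (∈-filter⁻ (T? ∘ p) x∈))))
                                (trans (cong G Fx≡Fy) (GF (proj₁ (∈-filter⁻ (T? ∘ p) y∈))))
  to : ∀ {z} → z ∈ map F (filterᵇ p xs) → z ∈ filterᵇ q xs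
  to z∈ with x , x∈ , refl ← ∈-map⁻ F z∈ with x∈xs , px ← ∈-filter⁻ (T? ∘ p) x∈ =
    ∈-filter⁺ (T? ∘ q) (F∈ x∈xs) (subst T (sym (q∘F≡p x∈xs)) px)
  from : ∀ {z} → z ∈ filterᵇ q xs → z ∈ map F (filterᵇ p xs)
  from {z} z∈ with z∈xs , qz ← ∈-filter⁻ (T? ∘ q) z∈ =
    subst (_∈ map F (filterᵇ p xs)) (FG z∈xs)
      (∈-map⁺ F (∈-filter⁺ (T? ∘ p) (G∈ z∈xs)
                           (subst T (trans (sym (cong q (FG z∈xs))) (q∘F≡p (G∈ z∈xs))) qz)))

-- Positions and transpositions

infixl 9 _‼_

-- Positions are 1-based as in the paper; π ‼ 0 is junk (it equals π ‼ 1).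
_‼_ : List ℕ → ℕ → ℕ
π ‼ m = nth π (m ∸ 1)

setAt : List ℕ → ℕ → ℕ → List ℕ
setAt []       _       _ = []
setAt (x ∷ xs) zero    v = v ∷ xs
setAt (x ∷ xs) (suc k) v = x ∷ setAt xs k v

length-setAt : (xs : List ℕ) (k v : ℕ) → length (setAt xs k v) ≡ length xs
length-setAt []       _       _ = refl
length-setAt (x ∷ xs) zero    _ = refl
length-setAt (x ∷ xs) (suc k) v = cong suc (length-setAt xs k v)

nth-setAt-≡ : (xs : List ℕ) {k : ℕ} (v : ℕ) → k < length xs → nth (setAt xs k v) k ≡ v
nth-setAt-≡ (x ∷ xs) {zero}  v _         = refl
nth-setAt-≡ (x ∷ xs) {suc k} v (s≤s k<) = nth-setAt-≡ xs v k<

nth-setAt-≢ : (xs : List ℕ) {k r : ℕ} (v : ℕ) → r ≢ k → nth (setAt xs k v) r ≡ nth xs r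
nth-setAt-≢ []       {_}     {_}     _ _   = refl
nth-setAt-≢ (x ∷ xs) {zero}  {zero}  _ r≢k = ⊥-elim (r≢k refl)
nth-setAt-≢ (x ∷ xs) {zero}  {suc r} _ _   = refl
nth-setAt-≢ (x ∷ xs) {suc k} {zero}  _ _   = refl
nth-setAt-≢ (x ∷ xs) {suc k} {suc r} v r≢k = nth-setAt-≢ xs v (r≢k ∘ cong suc)

All-setAt : {P : ℕ → Set} (xs : List ℕ) (k : ℕ) {v : ℕ} → All P xs → P v → All P (setAt xs k v)
All-setAt []       _       []         _  = []
All-setAt (x ∷ xs) zero    (_  ∷ pxs) pv = pv ∷ pxs
All-setAt (x ∷ xs) (suc k) (px ∷ pxs) pv = px ∷ All-setAt xs k pxs pv

δ : ℕ → ℕ → ℕ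
δ v x = if v ≡ᵇ x then 1 else 0

countOf-setAt : (v : ℕ) (xs : List ℕ) {k : ℕ} (w : ℕ) → k < length xs →
                countOf v (setAt xs k w) + δ v (nth xs k) ≡ countOf v xs + δ v w
countOf-setAt v (x ∷ xs) {zero} w _ = begin
  (δ v w + countOf v xs) + δ v x ≡⟨ +-assoc (δ v w) _ _ ⟩
  δ v w + (countOf v xs + δ v x) ≡⟨ +-comm (δ v w) _ ⟩
  (countOf v xs + δ v x) + δ v w ≡⟨ cong (_+ δ v w) (+-comm (countOf v xs) _) ⟩
  (δ v x + countOf v xs) + δ v w ∎
  where open ≡-Reasoning
countOf-setAt v (x ∷ xs) {suc k} w (s≤s k<) = begin
  (δ v x + countOf v (setAt xs k w)) + δ v (nth xs k) ≡⟨ +-assoc (δ v x) _ _ ⟩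
  δ v x + (countOf v (setAt xs k w) + δ v (nth xs k)) ≡⟨ cong (δ v x +_) (countOf-setAt v xs w k<) ⟩
  δ v x + (countOf v xs + δ v w)                      ≡⟨ +-assoc (δ v x) _ _ ⟨
  (δ v x + countOf v xs) + δ v w                      ∎
  where open ≡-Reasoning

swap : List ℕ → ℕ → ℕ → List ℕ
swap π p q = setAt (setAt π (p ∸ 1) (π ‼ q)) (q ∸ 1) (π ‼ p)

record Swapped (f g : ℕ → ℕ) (p q : ℕ) : Set where
  field
    1≤p       : 1 ≤ p
    p<q       : p < q
    at-p      : g p ≡ f q
    at-q      : g q ≡ f p
    elsewhere : ∀ {m} → 1 ≤ m → m ≢ p → m ≢ q → g m ≡ f m

  unchanged-below : ∀ {m} → 1 ≤ m → m < p → g m ≡ f m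
  unchanged-below 1≤m m<p = elsewhere 1≤m (<⇒≢ m<p) (<⇒≢ (<-trans m<p p<q))

  unchanged-between : ∀ {m} → p < m → m < q → g m ≡ f m
  unchanged-between p<m m<q = elsewhere (≤-trans 1≤p (<⇒≤ p<m)) (>⇒≢ p<m) (<⇒≢ m<q)

  unchanged-above : ∀ {m} → q < m → g m ≡ f m
  unchanged-above {m} q<m = elsewhere (≤-trans 1≤p (<⇒≤ p<m)) (>⇒≢ p<m) (>⇒≢ q<m)
    where
    p<m : p < m
    p<m = <-trans p<q q<m

Swapped-sym : ∀ {f g p q} → Swapped f g p q → Swapped g f p q
Swapped-sym s = record
  { 1≤p = 1≤p ; p<q = p<q ; at-p = sym at-q ; at-q = sym at-p
  ; elsewhere = λ 1≤m m≢p m≢q → sym (elsewhere 1≤m m≢p m≢q) }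
  where open Swapped s

module _ (π : List ℕ) {p q : ℕ} (1≤p : 1 ≤ p) (p<q : p < q) (q≤n : q ≤ length π) where

  private
    π₁ : List ℕ
    π₁ = setAt π (p ∸ 1) (π ‼ q)

    1≤q : 1 ≤ q
    1≤q = ≤-trans 1≤p (<⇒≤ p<q)

    p≤n : p ≤ length π
    p≤n = ≤-trans (<⇒≤ p<q) q≤n

    pred-≢ : ∀ {a b} → 1 ≤ a → 1 ≤ b → a ≢ b → a ∸ 1 ≢ b ∸ 1
    pred-≢ {suc a} {suc b} _ _ a≢b = a≢b ∘ cong suc

    pred-< : ∀ {a} → 1 ≤ a → a ≤ length π → a ∸ 1 < length π
    pred-< {suc a} _ a≤n = a≤n

    q-1<|π₁| : q ∸ 1 < length π₁
    q-1<|π₁| = subst (q ∸ 1 <_) (sym (length-setAt π _ _)) (pred-< 1≤q q≤n)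

  length-swap : length (swap π p q) ≡ length π
  length-swap = trans (length-setAt π₁ _ _) (length-setAt π _ _)

  swap-Swapped : Swapped (π ‼_) (swap π p q ‼_) p q
  swap-Swapped = record
    { 1≤p = 1≤p ; p<q = p<q
    ; at-p = trans (nth-setAt-≢ π₁ _ (pred-≢ 1≤p 1≤q (<⇒≢ p<q)))
                   (nth-setAt-≡ π _ (pred-< 1≤p p≤n))
    ; at-q = nth-setAt-≡ π₁ _ q-1<|π₁|
    ; elsewhere = λ 1≤m m≢p m≢q → trans (nth-setAt-≢ π₁ _ (pred-≢ 1≤m 1≤q m≢q))
                                        (nth-setAt-≢ π _ (pred-≢ 1≤m 1≤p m≢p)) }

  countOf-swap : (v : ℕ) → countOf v (swap π p q) ≡ countOf v π
  countOf-swap v = +-cancelʳ-≡ _ _ _ (begin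
    countOf v (swap π p q) + δ v (π ‼ q)          ≡⟨ cong (λ x → countOf v (swap π p q) + δ v x) π₁-at-q ⟨
    countOf v (swap π p q) + δ v (nth π₁ (q ∸ 1)) ≡⟨ countOf-setAt v π₁ _ q-1<|π₁| ⟩
    countOf v π₁ + δ v (π ‼ p)                    ≡⟨ countOf-setAt v π _ (pred-< 1≤p p≤n) ⟩
    countOf v π + δ v (π ‼ q)                     ∎)
    where
    open ≡-Reasoning
    π₁-at-q : nth π₁ (q ∸ 1) ≡ π ‼ q
    π₁-at-q = nth-setAt-≢ π _ (pred-≢ 1≤q 1≤p (>⇒≢ p<q))

swap-involutive : (π : List ℕ) {p q : ℕ} (1≤p : 1 ≤ p) (p<q : p < q) (q≤n : q ≤ length π) →
                  swap (swap π p q) p q ≡ π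
swap-involutive π {p} {q} 1≤p p<q q≤n =
  nth-ext (trans (length-swap π′ 1≤p p<q q≤|π′|) (length-swap π 1≤p p<q q≤n)) twice
  where
  π′ : List ℕ
  π′ = swap π p q
  q≤|π′| : q ≤ length π′
  q≤|π′| = subst (q ≤_) (sym (length-swap π 1≤p p<q q≤n)) q≤n
  module S = Swapped (swap-Swapped π 1≤p p<q q≤n)
  module S′ = Swapped (swap-Swapped π′ 1≤p p<q q≤|π′|)

  nth-ext : ∀ {xs ys} → length xs ≡ length ys → (∀ r → nth xs r ≡ nth ys r) → xs ≡ ys
  nth-ext {[]}     {[]}     _ _ = refl
  nth-ext {x ∷ xs} {y ∷ ys} |xs|≡|ys| xs≗ys =
    cong₂ _∷_ (xs≗ys 0) (nth-ext (cong pred |xs|≡|ys|) (xs≗ys ∘ suc))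

  twice : ∀ r → swap π′ p q ‼ suc r ≡ π ‼ suc r
  twice r with suc r ≟ p | suc r ≟ q
  ... | yes refl | _        = trans S′.at-p S.at-q
  ... | no _     | yes refl = trans S′.at-q S.at-p
  ... | no r≢p   | no r≢q   = trans (S′.elsewhere (s≤s z≤n) r≢p r≢q) (S.elsewhere (s≤s z≤n) r≢p r≢q)

-- Permutations

∈-range1⁺ : ∀ {m n} → 1 ≤ m → m ≤ n → m ∈ range1 n
∈-range1⁺ {suc m} _ m<n = ∈-map⁺ suc (∈-upTo⁺ m<n)

∈-range1⁻ : ∀ {m n} → m ∈ range1 n → 1 ≤ m × m ≤ n
∈-range1⁻ m∈ with k , k∈ , refl ← ∈-map⁻ suc m∈ = s≤s z≤n , ∈-upTo⁻ k∈

range1-increasing : (n : ℕ) → AllPairs _<_ (range1 n)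
range1-increasing n = AllPairs.map⁺ (AllPairs.applyUpTo⁺₁ (λ i → i) n (λ i<j _ → s≤s i<j))

range1-unique : (n : ℕ) → Unique (range1 n)
range1-unique n = AllPairs.map <⇒≢ (range1-increasing n)

concatMap-map : {A B C : Set} (f : A → B → C) (xs : List A) (ys : List B) →
                concatMap (λ x → map (f x) ys) xs ≡ cartesianProductWith f xs ys
concatMap-map f []       ys = refl
concatMap-map f (x ∷ xs) ys = cong (map (f x) ys ++_) (concatMap-map f xs ys)

private
  words-suc : (k n : ℕ) → words (suc k) n ≡ cartesianProductWith (λ w v → v ∷ w) (words k n) (range1 n)
  words-suc k n = concatMap-map (λ w v → v ∷ w) (words k n) (range1 n)

∈-words⁺ : ∀ {k n w} → length w ≡ k → All (_∈ range1 n) w → w ∈ words k n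
∈-words⁺ {zero}  {n} {[]}    _ []          = here refl
∈-words⁺ {suc k} {n} {v ∷ w} |w| (v∈ ∷ w∈) rewrite words-suc k n =
  ∈-cartesianProductWith⁺ (λ w v → v ∷ w) (∈-words⁺ (cong pred |w|) w∈) v∈

∈-words⁻ : ∀ k {n w} → w ∈ words k n → length w ≡ k × All (_∈ range1 n) w
∈-words⁻ zero    (here refl) = refl , []
∈-words⁻ (suc k) {n} w∈ rewrite words-suc k n
  with u , v , u∈ , v∈ , refl ← ∈-cartesianProductWith⁻ (λ w v → v ∷ w) (words k n) (range1 n) w∈
  with |u| , u⊆ ← ∈-words⁻ k u∈ = cong suc |u| , v∈ ∷ u⊆

words-unique : (k n : ℕ) → Unique (words k n)
words-unique zero    n = [] ∷ []
words-unique (suc k) n rewrite words-suc k n =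
  Unique.cartesianProductWith⁺ (λ w v → v ∷ w) (λ e → swap× (∷-injective e))
    (words-unique k n) (range1-unique n)
  where
  swap× : ∀ {A B : Set} → A × B → B × A
  swap× (a , b) = b , a

record IsPerm (n : ℕ) (π : List ℕ) : Set where
  field
    length≡ : length π ≡ n
    entries : All (_∈ range1 n) π
    counts  : T (isPermᵇ n π)

∈S⁺ : ∀ {n π} → IsPerm n π → π ∈ S n
∈S⁺ {n} P = ∈-filter⁺ (T? ∘ isPermᵇ n) (∈-words⁺ length≡ entries) counts
  where open IsPerm P

∈S⁻ : ∀ n {π} → π ∈ S n → IsPerm n π
∈S⁻ n π∈ with π∈words , counts ← ∈-filter⁻ (T? ∘ isPermᵇ n) π∈
           with length≡ , entries ← ∈-words⁻ n π∈words =
  record { length≡ = length≡ ; entries = entries ; counts = counts }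

S-unique : (n : ℕ) → Unique (S n)
S-unique n = filterᵇ-unique (isPermᵇ n) (words-unique n n)

nth-∈ : (xs : List ℕ) {k : ℕ} → k < length xs → nth xs k ∈ xs
nth-∈ (x ∷ xs) {zero}  _        = here refl
nth-∈ (x ∷ xs) {suc k} (s≤s k<) = there (nth-∈ xs k<)

δ-refl : (v : ℕ) → δ v v ≡ 1
δ-refl v rewrite Equivalence.to T-≡ (≡⇒≡ᵇ v v refl) = refl

countOf-nth : (xs : List ℕ) {k : ℕ} → k < length xs → 1 ≤ countOf (nth xs k) xs
countOf-nth (x ∷ xs) {zero}  _        rewrite δ-refl x = s≤s z≤n
countOf-nth (x ∷ xs) {suc k} (s≤s k<) = ≤-trans (countOf-nth xs k<) (m≤n+m _ _)

countOf-nth-twice : (xs : List ℕ) {a b : ℕ} → a < b → b < length xs → nth xs a ≡ nth xs b →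
                    2 ≤ countOf (nth xs a) xs
countOf-nth-twice (x ∷ xs) {zero}  {suc b} _         (s≤s b<) x≡ rewrite δ-refl x | x≡ =
  s≤s (countOf-nth xs b<)
countOf-nth-twice (x ∷ xs) {suc a} {suc b} (s≤s a<b) (s≤s b<) e =
  ≤-trans (countOf-nth-twice xs a<b b< e) (m≤n+m _ _)

module IsPermProperties {n : ℕ} {π : List ℕ} (P : IsPerm n π) where
  open IsPerm P

  private
    index< : ∀ {m} → 1 ≤ m → m ≤ n → m ∸ 1 < length π
    index< {suc m} _ m≤n = subst (m <_) (sym length≡) m≤n

  ‼-range : ∀ {m} → 1 ≤ m → m ≤ n → 1 ≤ π ‼ m × π ‼ m ≤ n
  ‼-range 1≤m m≤n = ∈-range1⁻ (All.lookup entries (nth-∈ π (index< 1≤m m≤n)))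

  private
    once : ∀ v → v ∈ range1 n → countOf v π ≡ 1
    once v v∈ = ≡ᵇ⇒≡ _ _ (All.lookup (All.all⁺ _ (range1 n) counts) v∈)

    repeated : ∀ {r s} → 1 ≤ r → r ≤ n → r < s → s ≤ n → π ‼ r ≡ π ‼ s → ⊥
    repeated {suc r} {suc s} _ r≤n (s≤s r<s) s≤n πr≡πs =
      <-irrefl refl (subst (2 ≤_) (once _ (All.lookup entries (nth-∈ π (index< (s≤s z≤n) r≤n))))
                                  (countOf-nth-twice π r<s (index< (s≤s z≤n) s≤n) πr≡πs))

  ‼-injective : ∀ {r s} → 1 ≤ r → r ≤ n → 1 ≤ s → s ≤ n → π ‼ r ≡ π ‼ s → r ≡ s
  ‼-injective {r} {s} 1≤r r≤n 1≤s s≤n πr≡πs with <-cmp r s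
  ... | tri≈ _ r≡s _ = r≡s
  ... | tri< r<s _ _ = ⊥-elim (repeated 1≤r r≤n r<s s≤n πr≡πs)
  ... | tri> _ _ s<r = ⊥-elim (repeated 1≤s s≤n s<r r≤n (sym πr≡πs))

IsPerm-swap : ∀ {n π p q} → IsPerm n π → 1 ≤ p → p < q → q ≤ n → IsPerm n (swap π p q)
IsPerm-swap {n} {π} {p} {q} P 1≤p p<q q≤n = record
  { length≡ = trans (length-swap π 1≤p p<q q≤|π|) length≡
  ; entries = All-setAt _ (q ∸ 1) (All-setAt π (p ∸ 1) entries (in-range 1≤q q≤n))
                        (in-range 1≤p (≤-trans (<⇒≤ p<q) q≤n))
  ; counts  = All.all⁻ _ (All.map (subst (λ c → T (c ≡ᵇ 1)) (sym (countOf-swap π 1≤p p<q q≤|π| _)))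
                                (All.all⁺ _ (range1 n) counts)) }
  where
  open IsPerm P
  open IsPermProperties P
  1≤q : 1 ≤ q
  1≤q = ≤-trans 1≤p (<⇒≤ p<q)
  q≤|π| : q ≤ length π
  q≤|π| = subst (q ≤_) (sym length≡) q≤n
  in-range : ∀ {m} → 1 ≤ m → m ≤ n → π ‼ m ∈ range1 n
  in-range 1≤m m≤n = ∈-range1⁺ (proj₁ (‼-range 1≤m m≤n)) (proj₂ (‼-range 1≤m m≤n))

-- Sites

data Pattern : Set where
  p123 p132 : Pattern

opposite : Pattern → Pattern
opposite p123 = p132
opposite p132 = p123

opposite-injective : ∀ {τ σ} → opposite τ ≡ opposite σ → τ ≡ σ
opposite-injective {p123} {p123} _ = refl
opposite-injective {p132} {p132} _ = refl

-- Orient τ b c lo hi: the entries b at position i + 1 and c at position j are lo < hi in the order of τ.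
data Orient : Pattern → ℕ → ℕ → ℕ → ℕ → Set where
  as123 : ∀ {lo hi} → Orient p123 lo hi lo hi
  as132 : ∀ {lo hi} → Orient p132 hi lo lo hi

orient-opposite : ∀ {τ b c lo hi} → Orient τ b c lo hi → Orient (opposite τ) c b lo hi
orient-opposite as123 = as132
orient-opposite as132 = as123

orient-bounds : ∀ {τ b c lo hi} → Orient τ b c lo hi → lo < hi → lo ≤ b × b ≤ hi
orient-bounds as123 lo<hi = ≤-refl , <⇒≤ lo<hi
orient-bounds as132 lo<hi = <⇒≤ lo<hi , ≤-refl

orient-hi< : ∀ {τ b c lo hi x} → Orient τ b c lo hi → b < x → c < x → hi < x
orient-hi< as123 _   c<x = c<x
orient-hi< as132 b<x _   = b<x

-- The shading R₀ read column by column, for positions i < i + 1 < j of f : positions → values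
-- whose two larger entries are lo < hi.
record Frame (f : ℕ → ℕ) (n i j lo hi : ℕ) : Set where
  field
    1≤i   : 1 ≤ i
    1+i<j : suc i < j
    j≤n   : j ≤ n
    fi<lo : f i < lo
    lo<hi : lo < hi
    left  : ∀ {m} → 1 ≤ m → m < i → lo < f m
    mid   : ∀ {m} → suc i < m → m < j → f m < f i
    right : ∀ {m} → j < m → m ≤ n → f m < f i ⊎ hi < f m

record Site (τ : Pattern) (f : ℕ → ℕ) (n i j : ℕ) : Set where
  constructor site
  field
    {lo hi} : ℕ
    frame   : Frame f n i j lo hi
    orient  : Orient τ (f (suc i)) (f j) lo hi

  open Frame frame public

  lo≤next : lo ≤ f (suc i)
  lo≤next = proj₁ (orient-bounds orient lo<hi)

  next≤hi : f (suc i) ≤ hi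
  next≤hi = proj₂ (orient-bounds orient lo<hi)

  lo≤partner : lo ≤ f j
  lo≤partner = proj₁ (orient-bounds (orient-opposite orient) lo<hi)

  fi<next : f i < f (suc i)
  fi<next = <-≤-trans fi<lo lo≤next

  fi<partner : f i < f j
  fi<partner = <-≤-trans fi<lo lo≤partner

  hi< : ∀ {x} → f (suc i) < x → f j < x → hi < x
  hi< next<x = orient-hi< orient next<x

orient-cong : ∀ {τ b c b′ c′ lo hi} → b′ ≡ b → c′ ≡ c → Orient τ b c lo hi → Orient τ b′ c′ lo hi
orient-cong refl refl o = o

site-opposite : ∀ {τ f g n i j} → Site τ f n i j → Swapped f g (suc i) j → Site (opposite τ) g n i j
site-opposite {τ} {f} {g} {n} {i} {j} S sw = site frame′ orient′
  where
  open Site S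
  module sw = Swapped sw
  gi≡fi : g i ≡ f i
  gi≡fi = sw.unchanged-below 1≤i (n<1+n i)
  frame′ : Frame g n i j lo hi
  frame′ = record
    { 1≤i = 1≤i ; 1+i<j = 1+i<j ; j≤n = j≤n ; lo<hi = lo<hi
    ; fi<lo = subst (_< lo) (sym gi≡fi) fi<lo
    ; left  = λ 1≤m m<i → subst (lo <_) (sym (sw.unchanged-below 1≤m (<-trans m<i (n<1+n i)))) (left 1≤m m<i)
    ; mid   = λ 1+i<m m<j → subst₂ _<_ (sym (sw.unchanged-between 1+i<m m<j)) (sym gi≡fi) (mid 1+i<m m<j)
    ; right = λ j<m m≤n → subst₂ (λ x y → x < y ⊎ hi < x) (sym (sw.unchanged-above j<m)) (sym gi≡fi)
                                (right j<m m≤n) }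
  orient′ : Orient (opposite τ) (g (suc i)) (g j) lo hi
  orient′ = orient-cong sw.at-p sw.at-q (orient-opposite orient)

-- A swap at one site keeps every other site

-- Placement F m v: the value v may stand at position m without violating the frame F.
data Placement {f n i j lo hi} (F : Frame f n i j lo hi) (m v : ℕ) : Set where
  inLeft  : 1 ≤ m → m < i → lo < v → Placement F m v
  inMid   : suc i < m → m < j → v < f i → Placement F m v
  inRight : j < m → v < f i ⊎ hi < v → Placement F m v

module _ {f n i j lo hi} {F : Frame f n i j lo hi} {m v : ℕ} where
  open Frame F

  private
    i<j : i < j
    i<j = <-trans (n<1+n i) 1+i<j

  placed-left : Placement F m v → m < i → lo < v
  placed-left (inLeft _ _ lo<v)   _   = lo<v
  placed-left (inMid 1+i<m _ _)   m<i = ⊥-elim (<-asym m<i (<-trans (n<1+n i) 1+i<m))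
  placed-left (inRight j<m _)     m<i = ⊥-elim (<-asym m<i (<-trans i<j j<m))

  placed-mid : Placement F m v → suc i < m → m < j → v < f i
  placed-mid (inLeft _ m<i _)  1+i<m _   = ⊥-elim (<-asym m<i (<-trans (n<1+n i) 1+i<m))
  placed-mid (inMid _ _ v<fi)  _     _   = v<fi
  placed-mid (inRight j<m _)   _     m<j = ⊥-elim (<-asym m<j j<m)

  placed-right : Placement F m v → j < m → v < f i ⊎ hi < v
  placed-right (inLeft _ m<i _) j<m = ⊥-elim (<-asym m<i (<-trans i<j j<m))
  placed-right (inMid _ m<j _)  j<m = ⊥-elim (<-asym m<j j<m)
  placed-right (inRight _ v∈)   _   = v∈

  placed-avoids : Placement F m v → m ≢ i × m ≢ suc i × m ≢ j
  placed-avoids (inLeft _ m<i _)     = <⇒≢ m<i , <⇒≢ (<-trans m<i (n<1+n i)) , <⇒≢ (<-trans m<i i<j)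
  placed-avoids (inMid 1+i<m m<j _)  = >⇒≢ (<-trans (n<1+n i) 1+i<m) , >⇒≢ 1+i<m , <⇒≢ m<j
  placed-avoids (inRight j<m _)      = >⇒≢ (<-trans i<j j<m) , >⇒≢ (<-trans 1+i<j j<m) , >⇒≢ j<m

module _ {f g n i j lo hi p q} (F : Frame f n i j lo hi) (sw : Swapped f g p q)
         (p-placed : Placement F p (f q)) (q-placed : Placement F q (f p)) where
  open Frame F
  open Swapped sw

  private
    moved : ∀ {m} (C : ℕ → Set) → 1 ≤ m → (∀ {v} → Placement F m v → C v) → C (f m) → C (g m)
    moved {m} C 1≤m readout Cfm with m ≟ p | m ≟ q
    ... | yes refl | _        = subst C (sym at-p) (readout p-placed)
    ... | no _     | yes refl = subst C (sym at-q) (readout q-placed)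
    ... | no m≢p   | no m≢q   = subst C (sym (elsewhere 1≤m m≢p m≢q)) Cfm

    fixed : ∀ {k} → 1 ≤ k → (∀ {m v} → Placement F m v → m ≢ k) → g k ≡ f k
    fixed 1≤k avoids = elsewhere 1≤k (≢-sym (avoids p-placed)) (≢-sym (avoids q-placed))

  fixed-i : g i ≡ f i
  fixed-i = fixed 1≤i (proj₁ ∘ placed-avoids)

  fixed-next : g (suc i) ≡ f (suc i)
  fixed-next = fixed (s≤s z≤n) (proj₁ ∘ proj₂ ∘ placed-avoids)

  fixed-partner : g j ≡ f j
  fixed-partner = fixed (≤-trans 1≤i (<⇒≤ (<-trans (n<1+n i) 1+i<j))) (proj₂ ∘ proj₂ ∘ placed-avoids)

  frame-swap-away : Frame g n i j lo hi
  frame-swap-away = record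
    { 1≤i = 1≤i ; 1+i<j = 1+i<j ; j≤n = j≤n ; lo<hi = lo<hi
    ; fi<lo = subst (_< lo) (sym fixed-i) fi<lo
    ; left  = λ 1≤m m<i → moved (lo <_) 1≤m (λ P → placed-left P m<i) (left 1≤m m<i)
    ; mid   = λ 1+i<m m<j → subst (_ <_) (sym fixed-i)
                (moved (_< f i) (≤-trans (s≤s z≤n) (<⇒≤ 1+i<m)) (λ P → placed-mid P 1+i<m m<j) (mid 1+i<m m<j))
    ; right = λ j<m m≤n → subst (λ x → _ < x ⊎ hi < _) (sym fixed-i)
                (moved (λ v → v < f i ⊎ hi < v) (≤-trans 1≤i (<⇒≤ (<-trans (<-trans (n<1+n i) 1+i<j) j<m)))
                       (λ P → placed-right P j<m) (right j<m m≤n)) }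

site-swap-away : ∀ {σ f g n i j p q} (S : Site σ f n i j) → Swapped f g p q →
                 Placement (Site.frame S) p (f q) → Placement (Site.frame S) q (f p) → Site σ g n i j
site-swap-away (site F o) sw p-placed q-placed =
  site (frame-swap-away F sw p-placed q-placed)
       (orient-cong (fixed-next F sw p-placed q-placed) (fixed-partner F sw p-placed q-placed) o)

-- The swap at the site i hits position i′ + 1 or j′ of the site i′ ≠ i: the site i′ survives,
-- possibly with another partner.

swap-into-next : ∀ {τ σ f g n i i′ j′} → Site τ f n i (suc i′) → Swapped f g (suc i) (suc i′) →
                 Site σ f n i′ j′ → suc i < i′ → Site σ g n i′ j′
swap-into-next S sw (site F′ as123) 1+i<i′ =
  ⊥-elim (<-asym (Frame.left F′ (Site.1≤i S) (<-trans (n<1+n _) 1+i<i′)) (Site.fi<partner S))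
swap-into-next {f = f} {g} {n} {i} {i′} {j′} S sw (site F′ as132) 1+i<i′ =
  site frame′ (orient-cong at-q (unchanged-above 1+i<j) as132)
  where
  module S = Site S
  open Frame F′
  open Swapped sw
  i<i′ : i < i′
  i<i′ = <-trans (n<1+n i) 1+i<i′
  gi′ : g i′ ≡ f i′
  gi′ = unchanged-between 1+i<i′ (n<1+n i′)
  frame′ : Frame g n i′ j′ (f j′) (f (suc i))
  frame′ = record
    { 1≤i = 1≤i ; 1+i<j = 1+i<j ; j≤n = j≤n
    ; fi<lo = subst (_< f j′) (sym gi′) fi<lo
    ; lo<hi = <-trans (left S.1≤i i<i′) S.fi<next
    ; left  = left′
    ; mid   = λ 1+i′<m m<j′ → subst₂ _<_ (sym (unchanged-above 1+i′<m)) (sym gi′) (mid 1+i′<m m<j′)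
    ; right = λ j′<m m≤n → subst₂ (λ x y → x < y ⊎ f (suc i) < x)
                             (sym (unchanged-above (<-trans 1+i<j j′<m))) (sym gi′) (right′ j′<m m≤n) }
    where
    left′ : ∀ {m} → 1 ≤ m → m < i′ → f j′ < g m
    left′ {m} 1≤m m<i′ with <-cmp m (suc i)
    ... | tri< m<1+i _ _ = subst (f j′ <_) (sym (unchanged-below 1≤m m<1+i)) (left 1≤m m<i′)
    ... | tri≈ _ refl _  = subst (f j′ <_) (sym at-p) lo<hi
    ... | tri> _ _ 1+i<m = subst (f j′ <_) (sym (unchanged-between 1+i<m (<-trans m<i′ (n<1+n i′)))) (left 1≤m m<i′)
    right′ : ∀ {m} → j′ < m → m ≤ n → f m < f i′ ⊎ f (suc i) < f m
    right′ {m} j′<m m≤n with right j′<m m≤n | S.right (<-trans 1+i<j j′<m) m≤n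
    ... | inj₁ fm<fi′ | _           = inj₁ fm<fi′
    ... | inj₂ _      | inj₂ hi<fm  = inj₂ (≤-<-trans S.next≤hi hi<fm)
    ... | inj₂ fj<fm  | inj₁ fm<fi  = ⊥-elim (<-asym fm<fi (<-trans S.fi<partner fj<fm))

swap-into-partner : ∀ {τ σ f g n i j i′} → Site τ f n i j → Swapped f g (suc i) j →
                    Site σ f n i′ j → suc i < i′ → suc i′ < j → Site σ g n i′ j
swap-into-partner S sw (site F′ as132) 1+i<i′ 1+i′<j =
  ⊥-elim (<-asym (Site.mid S (<-trans 1+i<i′ (n<1+n _)) 1+i′<j)
                 (<-trans (Site.fi<partner S) (Frame.lo<hi F′)))
swap-into-partner {f = f} {g} {n} {i} {j} {i′} S sw (site F′ as123) 1+i<i′ 1+i′<j =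
  site frame′ (orient-cong (unchanged-between 1+i<1+i′ 1+i′<j) at-q as123)
  where
  module S = Site S
  open Frame F′
  open Swapped sw
  1+i<1+i′ : suc i < suc i′
  1+i<1+i′ = <-trans 1+i<i′ (n<1+n i′)
  gi′ : g i′ ≡ f i′
  gi′ = unchanged-between 1+i<i′ (<-trans (n<1+n i′) 1+i′<j)
  frame′ : Frame g n i′ j (f (suc i′)) (f (suc i))
  frame′ = record
    { 1≤i = 1≤i ; 1+i<j = 1+i<j ; j≤n = j≤n
    ; fi<lo = subst (_< f (suc i′)) (sym gi′) fi<lo
    ; lo<hi = <-trans (S.mid 1+i<1+i′ 1+i′<j) S.fi<next
    ; left  = left′
    ; mid   = λ 1+i′<m m<j → subst₂ _<_ (sym (unchanged-between (<-trans 1+i<1+i′ 1+i′<m) m<j)) (sym gi′)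
                                       (mid 1+i′<m m<j)
    ; right = λ j<m m≤n → subst₂ (λ x y → x < y ⊎ f (suc i) < x) (sym (unchanged-above j<m)) (sym gi′)
                                 (right′ j<m m≤n) }
    where
    left′ : ∀ {m} → 1 ≤ m → m < i′ → f (suc i′) < g m
    left′ {m} 1≤m m<i′ with <-cmp m (suc i)
    ... | tri< m<1+i _ _ = subst (f (suc i′) <_) (sym (unchanged-below 1≤m m<1+i)) (left 1≤m m<i′)
    ... | tri≈ _ refl _  = subst (f (suc i′) <_) (sym at-p) lo<hi
    ... | tri> _ _ 1+i<m = subst (f (suc i′) <_) (sym (unchanged-between 1+i<m (<-trans m<i′ (<-trans (n<1+n i′) 1+i′<j))))
                                 (left 1≤m m<i′)
    right′ : ∀ {m} → j < m → m ≤ n → f m < f i′ ⊎ f (suc i) < f m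
    right′ {m} j<m m≤n with S.right j<m m≤n | right j<m m≤n
    ... | inj₂ hi<fm | _           = inj₂ (≤-<-trans S.next≤hi hi<fm)
    ... | inj₁ _     | inj₁ fm<fi′ = inj₁ fm<fi′
    ... | inj₁ fm<fi | inj₂ fj<fm  = ⊥-elim (<-asym fm<fi (<-trans S.fi<partner fj<fm))

swap-partner-leftward : ∀ {τ σ f g n i j i′} → Site τ f n i j → Swapped f g (suc i) j →
                        Site σ f n i′ j → suc i′ < i → Site σ g n i′ (suc i)
swap-partner-leftward {f = f} {g} {n} {i} {j} {i′} S sw (site {lo′} {hi′} F′ o′) 1+i′<i =
  site frame′ (orient-cong (unchanged-below (s≤s z≤n) 1+i′<1+i) at-p o′)
  where
  module S = Site S
  open Frame F′
  open Swapped sw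
  1+i′<1+i : suc i′ < suc i
  1+i′<1+i = <-trans 1+i′<i (n<1+n i)
  i′<i : i′ < i
  i′<i = <-trans (n<1+n i′) 1+i′<i
  gi′ : g i′ ≡ f i′
  gi′ = unchanged-below 1≤i (<-trans i′<i (n<1+n i))
  fi<fi′ : f i < f i′
  fi<fi′ = mid 1+i′<i (<-trans (n<1+n i) S.1+i<j)
  frame′ : Frame g n i′ (suc i) lo′ hi′
  frame′ = record
    { 1≤i = 1≤i ; 1+i<j = 1+i′<1+i ; j≤n = ≤-trans (<⇒≤ S.1+i<j) S.j≤n ; lo<hi = lo<hi
    ; fi<lo = subst (_< lo′) (sym gi′) fi<lo
    ; left  = λ 1≤m m<i′ → subst (lo′ <_) (sym (unchanged-below 1≤m (<-trans m<i′ (<-trans i′<i (n<1+n i)))))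
                                 (left 1≤m m<i′)
    ; mid   = λ 1+i′<m m<1+i → subst₂ _<_ (sym (unchanged-below (≤-trans (s≤s z≤n) (<⇒≤ 1+i′<m)) m<1+i))
                                         (sym gi′)
                                         (mid 1+i′<m (<-trans m<1+i S.1+i<j))
    ; right = λ 1+i<m m≤n → subst (λ y → g _ < y ⊎ hi′ < g _) (sym gi′) (right′ 1+i<m m≤n) }
    where
    right′ : ∀ {m} → suc i < m → m ≤ n → g m < f i′ ⊎ hi′ < g m
    right′ {m} 1+i<m m≤n with <-cmp m j
    ... | tri< m<j _ _ = inj₁ (subst (_< f i′) (sym (unchanged-between 1+i<m m<j)) (<-trans (S.mid 1+i<m m<j) fi<fi′))
    ... | tri≈ _ refl _ = inj₁ (subst (_< f i′) (sym at-q) (mid 1+i′<1+i S.1+i<j))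
    ... | tri> _ _ j<m = Sum.map (subst (_< f i′) (sym (unchanged-above j<m))) (subst (hi′ <_) (sym (unchanged-above j<m)))
                                 (right j<m m≤n)

swap-partner-rightward : ∀ {τ σ f g n i j i′} → Site τ f n i j → Swapped f g (suc i) j →
                         Site σ f n i′ (suc i) → suc i′ < i → Site σ g n i′ j
swap-partner-rightward (site F as123) sw S′ 1+i′<i =
  ⊥-elim (<-asym (Frame.left F (Site.1≤i S′) (<-trans (n<1+n _) 1+i′<i)) (Site.fi<partner S′))
swap-partner-rightward {f = f} {g} {n} {i} {j} {i′} (site F as132) sw (site {lo′} {hi′} F′ o′) 1+i′<i =
  site frame′ (orient-cong (unchanged-below (s≤s z≤n) 1+i′<1+i) at-q o′)
  where
  module S = Frame F
  open Frame F′
  open Swapped sw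
  1+i′<1+i : suc i′ < suc i
  1+i′<1+i = <-trans 1+i′<i (n<1+n i)
  i′<i : i′ < i
  i′<i = <-trans (n<1+n i′) 1+i′<i
  gi′ : g i′ ≡ f i′
  gi′ = unchanged-below 1≤i (<-trans i′<i (n<1+n i))
  frame′ : Frame g n i′ j lo′ hi′
  frame′ = record
    { 1≤i = 1≤i ; 1+i<j = <-trans 1+i′<1+i S.1+i<j ; j≤n = S.j≤n ; lo<hi = lo<hi
    ; fi<lo = subst (_< lo′) (sym gi′) fi<lo
    ; left  = λ 1≤m m<i′ → subst (lo′ <_) (sym (unchanged-below 1≤m (<-trans m<i′ (<-trans i′<i (n<1+n i)))))
                                 (left 1≤m m<i′)
    ; mid   = λ 1+i′<m m<j → subst (g _ <_) (sym gi′) (mid′ 1+i′<m m<j)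
    ; right = λ j<m m≤n → subst₂ (λ x y → x < y ⊎ hi′ < x) (sym (unchanged-above j<m)) (sym gi′)
                                 (right (<-trans S.1+i<j j<m) m≤n) }
    where
    mid′ : ∀ {m} → suc i′ < m → m < j → g m < f i′
    mid′ {m} 1+i′<m m<j with <-cmp m (suc i)
    ... | tri< m<1+i _ _ = subst (_< f i′) (sym (unchanged-below (≤-trans (s≤s z≤n) (<⇒≤ 1+i′<m)) m<1+i))
                                 (mid 1+i′<m m<1+i)
    ... | tri≈ _ refl _  = subst (_< f i′) (sym at-p) (S.left 1≤i i′<i)
    ... | tri> _ _ 1+i<m = subst (_< f i′) (sym (unchanged-between 1+i<m m<j))
                                 (<-trans (S.mid 1+i<m m<j) (mid 1+i′<i (n<1+n i)))

private
  1≤-< : ∀ {k m} → 1 ≤ k → k < m → 1 ≤ m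
  1≤-< 1≤k k<m = ≤-trans 1≤k (<⇒≤ k<m)

  survives-right : ∀ {τ σ f g n i j i′ j′} → Site τ f n i j → Swapped f g (suc i) j →
                   Site σ f n i′ j′ → i < i′ → ∃[ j″ ] Site σ g n i′ j″
  survives-right {f = f} {i = i} {j} {i′} {j′} S sw S′ i<i′ with m≤n⇒m<n∨m≡n i<i′
  ... | inj₂ refl = ⊥-elim (<-asym (S′.left S.1≤i i<i′) (<-trans S.fi<next S′.fi<lo))
    where
    module S = Site S
    module S′ = Site S′
  ... | inj₁ 1+i<i′ with <-cmp i′ j
  ...   | tri≈ _ refl _ = ⊥-elim (<-asym (S′.left S.1≤i i<i′) (<-trans S.fi<partner S′.fi<lo))
    where
    module S = Site S
    module S′ = Site S′
  ...   | tri> _ _ j<i′ = j′ , site-swap-away S′ sw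
          (inLeft (s≤s z≤n) 1+i<i′ (S′.left (1≤-< (s≤s z≤n) S.1+i<j) j<i′))
          (inLeft (1≤-< (s≤s z≤n) S.1+i<j) j<i′ (S′.left (s≤s z≤n) 1+i<i′))
    where
    module S = Site S
    module S′ = Site S′
  ...   | tri< i′<j _ _ with m≤n⇒m<n∨m≡n i′<j
  ...     | inj₂ refl = j′ , swap-into-next S sw S′ 1+i<i′
  ...     | inj₁ 1+i′<j with <-cmp j′ j
  ...       | tri≈ _ refl _ = j , swap-into-partner S sw S′ 1+i<i′ 1+i′<j
  ...       | tri> _ _ j<j′ = ⊥-elim (<-asym (S′.mid 1+i′<j j<j′) (<-trans (S.mid 1+i<i′ i′<j) S.fi<partner))
    where
    module S = Site S
    module S′ = Site S′
  ...       | tri< j′<j _ _ = j′ , site-swap-away S′ sw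
          (inLeft (s≤s z≤n) 1+i<i′ (≤-<-trans S′.lo≤next (<-trans fi′+1<fi S.fi<partner)))
          (inRight j′<j (inj₂ (S′.hi< (<-trans fi′+1<fi S.fi<next) (<-trans fj′<fi S.fi<next))))
    where
    module S = Site S
    module S′ = Site S′
    1+i<1+i′ : suc i < suc i′
    1+i<1+i′ = <-trans 1+i<i′ (n<1+n i′)
    fi′+1<fi : f (suc i′) < f i
    fi′+1<fi = S.mid 1+i<1+i′ 1+i′<j
    fj′<fi : f j′ < f i
    fj′<fi = S.mid (<-trans 1+i<1+i′ S′.1+i<j) j′<j

  survives-left : ∀ {τ σ f g n i j i′ j′} → Site τ f n i j → Swapped f g (suc i) j →
                  Site σ f n i′ j′ → i′ < i → ∃[ j″ ] Site σ g n i′ j″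
  survives-left {f = f} {i = i} {j} {i′} {j′} S sw S′ i′<i with m≤n⇒m<n∨m≡n i′<i
  ... | inj₂ refl = ⊥-elim (<-asym (S.left S′.1≤i i′<i) (<-trans S′.fi<next S.fi<lo))
    where
    module S = Site S
    module S′ = Site S′
  ... | inj₁ 1+i′<i with <-cmp i j′
  ...   | tri≈ _ refl _ = ⊥-elim (<-asym (S.left S′.1≤i i′<i) (<-trans S′.fi<partner S.fi<lo))
    where
    module S = Site S
    module S′ = Site S′
  ...   | tri> _ _ j′<i = j′ , site-swap-away S′ sw
          (inRight j′<1+i (S′.right j′<j S.j≤n))
          (inRight j′<j (S′.right j′<1+i (≤-trans (<⇒≤ S.1+i<j) S.j≤n)))
    where
    module S = Site S
    module S′ = Site S′
    j′<1+i : j′ < suc i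
    j′<1+i = <-trans j′<i (n<1+n i)
    j′<j : j′ < j
    j′<j = <-trans j′<1+i S.1+i<j
  ...   | tri< i<j′ _ _ with m≤n⇒m<n∨m≡n i<j′
  ...     | inj₂ refl = j , swap-partner-rightward S sw S′ 1+i′<i
  ...     | inj₁ 1+i<j′ with <-cmp j j′
  ...       | tri≈ _ refl _ = suc i , swap-partner-leftward S sw S′ 1+i′<i
  ...       | tri> _ _ j′<j = ⊥-elim (<-asym (S.mid 1+i<j′ j′<j) (<-trans (S′.mid 1+i′<i i<j′) S′.fi<partner))
    where
    module S = Site S
    module S′ = Site S′
  ...       | tri< j<j′ _ _ = j′ , site-swap-away S′ sw
          (inMid 1+i′<1+i 1+i<j′ (S′.mid 1+i′<j j<j′))
          (inMid 1+i′<j j<j′ (S′.mid 1+i′<1+i 1+i<j′))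
    where
    module S = Site S
    module S′ = Site S′
    1+i′<1+i : suc i′ < suc i
    1+i′<1+i = <-trans 1+i′<i (n<1+n i)
    1+i′<j : suc i′ < j
    1+i′<j = <-trans 1+i′<1+i S.1+i<j

site-survives-swap : ∀ {τ σ f g n i j i′ j′} → Site τ f n i j → Swapped f g (suc i) j →
                     Site σ f n i′ j′ → i′ ≢ i → ∃[ j″ ] Site σ g n i′ j″
site-survives-swap {i = i} {i′ = i′} S sw S′ i′≢i with <-cmp i i′
... | tri< i<i′ _ _ = survives-right S sw S′ i<i′
... | tri≈ _ i≡i′ _ = ⊥-elim (i′≢i (sym i≡i′))
... | tri> _ _ i′<i = survives-left S sw S′ i′<i

firstAbove : (ℕ → ℕ) → ℕ → ℕ → ℕ → ℕ
firstAbove f x m zero       = m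
firstAbove f x m (suc fuel) = if x <ᵇ f m then m else firstAbove f x (suc m) fuel

firstAbove-spec : ∀ {f x m j} fuel → m ≤ j → j < m + fuel → (∀ {r} → m ≤ r → r < j → f r < x) → x < f j →
                  firstAbove f x m fuel ≡ j
firstAbove-spec {m = m} zero m≤j j<m+0 _ _ = ⊥-elim (<-irrefl refl (≤-<-trans m≤j (subst (_ <_) (+-identityʳ m) j<m+0)))
firstAbove-spec {f} {x} {m} {j} (suc fuel) m≤j j<m+1+fuel below x<fj
  with x <ᵇ f m in x<ᵇfm | m≤n⇒m<n∨m≡n m≤j
... | true  | inj₂ m≡j  = m≡j
... | true  | inj₁ m<j  = ⊥-elim (<-asym (below ≤-refl m<j) (<ᵇ⇒< x (f m) (subst T (sym x<ᵇfm) tt)))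
... | false | inj₂ refl = ⊥-elim (subst T x<ᵇfm (<⇒<ᵇ x<fj))
... | false | inj₁ m<j  = firstAbove-spec fuel m<j (subst (j <_) (+-suc m fuel) j<m+1+fuel)
                            (λ 1+m≤r → below (≤-trans (n≤1+n m) 1+m≤r)) x<fj

partner : (ℕ → ℕ) → ℕ → ℕ → ℕ
partner f n i = firstAbove f (f i) (suc (suc i)) n

site-partner : ∀ {τ f n i j} → Site τ f n i j → j ≡ partner f n i
site-partner {n = n} {i} S = sym (firstAbove-spec n 1+i<j (s≤s (≤-trans j≤n (m≤n+m n (suc i)))) mid fi<partner)
  where open Site S

orient-unique : ∀ {τ σ b c lo hi lo′ hi′} →
                Orient τ b c lo hi → lo < hi → Orient σ b c lo′ hi′ → lo′ < hi′ → τ ≡ σ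
orient-unique as123 _     as123 _       = refl
orient-unique as132 _     as132 _       = refl
orient-unique as123 b<c   as132 c<b     = ⊥-elim (<-asym b<c c<b)
orient-unique as132 c<b   as123 b<c     = ⊥-elim (<-asym b<c c<b)

site-partner-unique : ∀ {τ σ f n i j j′} → Site τ f n i j → Site σ f n i j′ → j ≡ j′
site-partner-unique S S′ = trans (site-partner S) (sym (site-partner S′))

site-pattern-unique : ∀ {τ σ f n i j j′} → Site τ f n i j → Site σ f n i j′ → τ ≡ σ
site-pattern-unique S S′ with refl ← site-partner-unique S S′ =
  orient-unique (Site.orient S) (Site.lo<hi S) (Site.orient S′) (Site.lo<hi S′)

-- Occurrences of the two mesh patterns are sites

word : Pattern → List ℕ
word p123 = 1 ∷ 2 ∷ 3 ∷ []
word p132 = 1 ∷ 3 ∷ 2 ∷ []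

meshOf : Pattern → MeshPattern
meshOf τ = mesh (word τ) R₀

-- Opaque so that T (emptyᵇ π x x′ y y′) does not unfold and its arguments can be inferred.
opaque
  emptyᵇ : List ℕ → ℕ → ℕ → ℕ → ℕ → Bool
  emptyᵇ π x x′ y y′ = not (any (λ m → between x m x′ ∧ between y (π ‼ m) y′) (range1 (length π)))

emptyBoxᵇ : List ℕ → List ℕ → List ℕ → ℕ × ℕ → Bool
emptyBoxᵇ π I V (a , b) = emptyᵇ π (nth I a) (nth I (suc a)) (nth V b) (nth V (suc b))

emptyBoxesᵇ : List ℕ → List ℕ → List ℕ → Bool
emptyBoxesᵇ π I V = all (emptyBoxᵇ π I V) R₀

columns : List ℕ → ℕ → ℕ → ℕ → List ℕ
columns π i k j = 0 ∷ i ∷ k ∷ j ∷ suc (length π) ∷ []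

rows : List ℕ → List ℕ → List ℕ
rows π s = 0 ∷ s ++ [ suc (length π) ]

opaque
  unfolding emptyᵇ

  isOccᵇ-unfold : ∀ τ π i k j →
    isOccᵇ (mesh τ R₀) π (i ∷ k ∷ j ∷ []) ≡
    orderIsoᵇ (π ‼ i ∷ π ‼ k ∷ π ‼ j ∷ []) τ ∧
    emptyBoxesᵇ π (columns π i k j) (rows π (sort (π ‼ i ∷ π ‼ k ∷ π ‼ j ∷ [])))
  isOccᵇ-unfold τ π i k j = refl

record Ordered (τ : Pattern) (x y z : ℕ) : Set where
  constructor ordered
  field
    {lo hi} : ℕ
    x<lo    : x < lo
    lo<hi   : lo < hi
    orient  : Orient τ y z lo hi

private
  <ᵇ-true : ∀ {a b} → a < b → (a <ᵇ b) ≡ true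
  <ᵇ-true a<b = Equivalence.to T-≡ (<⇒<ᵇ a<b)

  <ᵇ-false : ∀ {a b} → ¬ a < b → (a <ᵇ b) ≡ false
  <ᵇ-false {a} {b} a≮b with a <ᵇ b in a<ᵇb
  ... | true  = ⊥-elim (a≮b (<ᵇ⇒< a b (subst T (sym a<ᵇb) _)))
  ... | false = refl

  ==ᴮ⇒ : ∀ {c d} → T (c ==ᴮ d) → T d → T c
  ==ᴮ⇒ {true}           _  _  = _
  ==ᴮ⇒ {false} {true}  () _
  ==ᴮ⇒ {false} {false} _  ()

  orderIso-< : ∀ xs ys {a b} → T (orderIsoᵇ xs ys) → a ∈ upTo (length xs) → b ∈ upTo (length xs) →
               T (nth ys a <ᵇ nth ys b) → nth xs a < nth xs b
  orderIso-< xs ys h a∈ b∈ ys[a]<ys[b] =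
    <ᵇ⇒< _ _ (==ᴮ⇒ (All.lookup (All.all⁺ _ _ (All.lookup (All.all⁺ _ _ (proj₂ (Equivalence.to T-∧ h))) a∈))
                               b∈)
                  ys[a]<ys[b])

  #0 : 0 ∈ upTo 3
  #0 = here refl
  #1 : 1 ∈ upTo 3
  #1 = there (here refl)
  #2 : 2 ∈ upTo 3
  #2 = there (there (here refl))

orderIsoᵇ⇒Ordered : ∀ τ {x y z} → T (orderIsoᵇ (x ∷ y ∷ z ∷ []) (word τ)) → Ordered τ x y z
orderIsoᵇ⇒Ordered p123 {x} {y} {z} h =
  ordered (orderIso-< xyz (1 ∷ 2 ∷ 3 ∷ []) h #0 #1 _) (orderIso-< xyz (1 ∷ 2 ∷ 3 ∷ []) h #1 #2 _) as123
  where xyz = x ∷ y ∷ z ∷ []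
orderIsoᵇ⇒Ordered p132 {x} {y} {z} h =
  ordered (orderIso-< xyz (1 ∷ 3 ∷ 2 ∷ []) h #0 #2 _) (orderIso-< xyz (1 ∷ 3 ∷ 2 ∷ []) h #2 #1 _) as132
  where xyz = x ∷ y ∷ z ∷ []

Ordered⇒orderIsoᵇ : ∀ {τ x y z} → Ordered τ x y z → T (orderIsoᵇ (x ∷ y ∷ z ∷ []) (word τ))
Ordered⇒orderIsoᵇ {x = x} {y} {z} (ordered x<y y<z as123)
  rewrite <ᵇ-false (n≮n x) | <ᵇ-false (n≮n y) | <ᵇ-false (n≮n z)
        | <ᵇ-true x<y | <ᵇ-true y<z | <ᵇ-true (<-trans x<y y<z)
        | <ᵇ-false (<-asym x<y) | <ᵇ-false (<-asym y<z) | <ᵇ-false (<-asym (<-trans x<y y<z)) = _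
Ordered⇒orderIsoᵇ {x = x} {y} {z} (ordered x<z z<y as132)
  rewrite <ᵇ-false (n≮n x) | <ᵇ-false (n≮n y) | <ᵇ-false (n≮n z)
        | <ᵇ-true x<z | <ᵇ-true z<y | <ᵇ-true (<-trans x<z z<y)
        | <ᵇ-false (<-asym x<z) | <ᵇ-false (<-asym z<y) | <ᵇ-false (<-asym (<-trans x<z z<y)) = _

Ordered⇒sort : ∀ {τ x y z} (O : Ordered τ x y z) →
               sort (x ∷ y ∷ z ∷ []) ≡ x ∷ Ordered.lo O ∷ Ordered.hi O ∷ []
Ordered⇒sort (ordered x<y y<z as123) rewrite <ᵇ-true y<z | <ᵇ-true x<y = refl
Ordered⇒sort (ordered x<z z<y as132) rewrite <ᵇ-false (<-asym z<y) | <ᵇ-true x<z = refl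

record Empty (π : List ℕ) (x x′ y y′ : ℕ) : Set where
  constructor empty
  field
    no-entry : ∀ {m} → 1 ≤ m → m ≤ length π → x < m → m < x′ → y < π ‼ m → π ‼ m < y′ → ⊥
open Empty

private
  T-not⇒¬T : ∀ {b} → T (not b) → ¬ T b
  T-not⇒¬T {false} _ ()

  ¬T⇒T-not : ∀ {b} → ¬ T b → T (not b)
  ¬T⇒T-not {true}  ¬t = ¬t _
  ¬T⇒T-not {false} _  = _

  between⁺ : ∀ {x m x′} → x < m → m < x′ → T (between x m x′)
  between⁺ x<m m<x′ = Equivalence.from T-∧ (<⇒<ᵇ x<m , <⇒<ᵇ m<x′)

  between⁻ : ∀ x m x′ → T (between x m x′) → x < m × m < x′
  between⁻ x m x′ t with x<m , m<x′ ← Equivalence.to T-∧ t = <ᵇ⇒< x m x<m , <ᵇ⇒< m x′ m<x′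

opaque
  unfolding emptyᵇ

  emptyᵇ⇒Empty : ∀ {π x x′ y y′} → T (emptyᵇ π x x′ y y′) → Empty π x x′ y y′
  emptyᵇ⇒Empty h = empty λ 1≤m m≤n x<m m<x′ y<πm πm<y′ →
    T-not⇒¬T h (Any.any⁺ _ (lose (∈-range1⁺ 1≤m m≤n)
                                 (Equivalence.from T-∧ (between⁺ x<m m<x′ , between⁺ y<πm πm<y′))))

  Empty⇒emptyᵇ : ∀ {π x x′ y y′} → Empty π x x′ y y′ → T (emptyᵇ π x x′ y y′)
  Empty⇒emptyᵇ {π} {x} {x′} {y} {y′} e = ¬T⇒T-not λ h →
    let m , m∈ , t = find (Any.any⁻ _ (range1 (length π)) h)
        1≤m , m≤n = ∈-range1⁻ m∈
        t₁ , t₂ = Equivalence.to (T-∧ {between x m x′}) t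
        x<m , m<x′ = between⁻ x m x′ t₁
        y<πm , πm<y′ = between⁻ y (π ‼ m) y′ t₂
    in no-entry e 1≤m m≤n x<m m<x′ y<πm πm<y′

Empty-merge : ∀ {π x x′ y z y′} → Empty π x x′ y z → Empty π x x′ z y′ →
              (∀ {m} → 1 ≤ m → m ≤ length π → x < m → m < x′ → π ‼ m ≢ z) → Empty π x x′ y y′
Empty-merge {π} {x} {x′} {y} {z} {y′} below above avoids = empty merged
  where
  merged : ∀ {m} → 1 ≤ m → m ≤ length π → x < m → m < x′ → y < π ‼ m → π ‼ m < y′ → ⊥
  merged {m} 1≤m m≤n x<m m<x′ y<πm πm<y′ with <-cmp (π ‼ m) z
  ... | tri< πm<z _ _ = no-entry below 1≤m m≤n x<m m<x′ y<πm πm<z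
  ... | tri≈ _ πm≡z _ = avoids 1≤m m≤n x<m m<x′ πm≡z
  ... | tri> _ _ z<πm = no-entry above 1≤m m≤n x<m m<x′ z<πm πm<y′

orient-avoids : ∀ {τ b c lo hi x} → Orient τ b c lo hi → x ≢ b → x ≢ c → x ≢ lo × x ≢ hi
orient-avoids as123 x≢b x≢c = x≢b , x≢c
orient-avoids as132 x≢b x≢c = x≢c , x≢b

boxes⇒frame : ∀ {τ π i k j} → IsPerm (length π) π → 1 ≤ i → i < k → k < j → j ≤ length π →
              (O : Ordered τ (π ‼ i) (π ‼ k) (π ‼ j)) →
              T (emptyBoxesᵇ π (columns π i k j) (rows π (π ‼ i ∷ Ordered.lo O ∷ Ordered.hi O ∷ []))) →
              k ≡ suc i × Frame (π ‼_) (length π) i j (Ordered.lo O) (Ordered.hi O)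
boxes⇒frame {τ} {π} {i} {k} {j} P 1≤i i<k k<j j≤n O h
  with e00 ∷ e01 ∷ e10 ∷ e11 ∷ e12 ∷ e13 ∷ e21 ∷ e22 ∷ e23 ∷ e31 ∷ e32 ∷ []
         ← All.all⁺ (emptyBoxᵇ π (columns π i k j) (rows π (π ‼ i ∷ Ordered.lo O ∷ Ordered.hi O ∷ []))) R₀ h =
  k≡1+i , record
    { 1≤i = 1≤i ; 1+i<j = subst (_< j) k≡1+i k<j ; j≤n = j≤n ; fi<lo = x<lo ; lo<hi = lo<hi
    ; left = left ; mid = mid ; right = right }
  where
  open Ordered O
  open IsPermProperties P
  n : ℕ
  n = length π
  i<j : i < j
  i<j = <-trans i<k k<j

  below-j : ∀ {m} → m < j → m ≤ n
  below-j m<j = ≤-trans (<⇒≤ m<j) j≤n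

  right-of-i : ∀ {m} → i < m → 1 ≤ m
  right-of-i i<m = ≤-trans 1≤i (<⇒≤ i<m)

  value>0 : ∀ {m} → 1 ≤ m → m ≤ n → 0 < π ‼ m
  value>0 1≤m m≤n = proj₁ (‼-range 1≤m m≤n)

  value≤n : ∀ {m} → 1 ≤ m → m ≤ n → π ‼ m < suc n
  value≤n 1≤m m≤n = s≤s (proj₂ (‼-range 1≤m m≤n))

  Away : ℕ → ℕ → Set
  Away x x′ = ∀ {m} → x < m → m < x′ → m ≢ i × m ≢ k × m ≢ j

  away₀ : Away 0 i
  away₀ _ m<i = <⇒≢ m<i , <⇒≢ (<-trans m<i i<k) , <⇒≢ (<-trans m<i i<j)
  away₁ : Away i k
  away₁ i<m m<k = >⇒≢ i<m , <⇒≢ m<k , <⇒≢ (<-trans m<k k<j)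
  away₂ : Away k j
  away₂ k<m m<j = >⇒≢ (<-trans i<k k<m) , >⇒≢ k<m , <⇒≢ m<j
  away₃ : Away j (suc n)
  away₃ j<m _ = >⇒≢ (<-trans i<j j<m) , >⇒≢ (<-trans k<j j<m) , >⇒≢ j<m

  distinct : ∀ {x x′} → Away x x′ → ∀ {m} → 1 ≤ m → m ≤ n → x < m → m < x′ →
             π ‼ m ≢ π ‼ i × π ‼ m ≢ lo × π ‼ m ≢ hi
  distinct away 1≤m m≤n x<m m<x′ with m≢i , m≢k , m≢j ← away x<m m<x′ =
    m≢i ∘ ‼-injective 1≤m m≤n 1≤i (below-j i<j) ,
    orient-avoids orient (m≢k ∘ ‼-injective 1≤m m≤n (≤-trans 1≤i (<⇒≤ i<k)) (below-j k<j))
                         (m≢j ∘ ‼-injective 1≤m m≤n (≤-trans 1≤i (<⇒≤ i<j)) j≤n)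

  column₀ : Empty π 0 i 0 lo
  column₀ = Empty-merge (emptyᵇ⇒Empty e00) (emptyᵇ⇒Empty e01)
                        λ 1≤m m≤n 0<m m<i → proj₁ (distinct away₀ 1≤m m≤n 0<m m<i)
  column₁ : Empty π i k 0 (suc n)
  column₁ = Empty-merge (Empty-merge (Empty-merge (emptyᵇ⇒Empty e10) (emptyᵇ⇒Empty e11)
                                        λ 1≤m m≤n i<m m<k → proj₁ (distinct away₁ 1≤m m≤n i<m m<k))
                                     (emptyᵇ⇒Empty e12)
                                     λ 1≤m m≤n i<m m<k → proj₁ (proj₂ (distinct away₁ 1≤m m≤n i<m m<k)))
                        (emptyᵇ⇒Empty e13)
                        λ 1≤m m≤n i<m m<k → proj₂ (proj₂ (distinct away₁ 1≤m m≤n i<m m<k))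
  column₂ : Empty π k j (π ‼ i) (suc n)
  column₂ = Empty-merge (Empty-merge (emptyᵇ⇒Empty e21) (emptyᵇ⇒Empty e22)
                                     λ 1≤m m≤n k<m m<j → proj₁ (proj₂ (distinct away₂ 1≤m m≤n k<m m<j)))
                        (emptyᵇ⇒Empty e23)
                        λ 1≤m m≤n k<m m<j → proj₂ (proj₂ (distinct away₂ 1≤m m≤n k<m m<j))
  column₃ : Empty π j (suc n) (π ‼ i) hi
  column₃ = Empty-merge (emptyᵇ⇒Empty e31) (emptyᵇ⇒Empty e32)
                        λ 1≤m m≤n j<m m<1+n → proj₁ (proj₂ (distinct away₃ 1≤m m≤n j<m m<1+n))

  k≡1+i : k ≡ suc i
  k≡1+i with m≤n⇒m<n∨m≡n i<k
  ... | inj₂ 1+i≡k = sym 1+i≡k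
  ... | inj₁ 1+i<k =
    ⊥-elim (no-entry column₁ (s≤s z≤n) m≤n (n<1+n i) 1+i<k (value>0 (s≤s z≤n) m≤n) (value≤n (s≤s z≤n) m≤n))
    where m≤n = below-j (<-trans 1+i<k k<j)

  left : ∀ {m} → 1 ≤ m → m < i → lo < π ‼ m
  left {m} 1≤m m<i = ≤∧≢⇒< (≮⇒≥ (no-entry column₀ 1≤m m≤n 1≤m m<i (value>0 1≤m m≤n)))
                           (≢-sym (proj₁ (proj₂ (distinct away₀ 1≤m m≤n 1≤m m<i))))
    where
    m≤n : m ≤ n
    m≤n = below-j (<-trans m<i i<j)

  mid : ∀ {m} → suc i < m → m < j → π ‼ m < π ‼ i
  mid {m} 1+i<m m<j = ≤∧≢⇒< (≮⇒≥ λ πi<πm → no-entry column₂ 1≤m m≤n k<m m<j πi<πm (value≤n 1≤m m≤n))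
                            (proj₁ (distinct away₂ 1≤m m≤n k<m m<j))
    where
    k<m : k < m
    k<m = subst (_< m) (sym k≡1+i) 1+i<m
    1≤m : 1 ≤ m
    1≤m = right-of-i (<-trans (n<1+n i) 1+i<m)
    m≤n : m ≤ n
    m≤n = below-j m<j

  right : ∀ {m} → j < m → m ≤ n → π ‼ m < π ‼ i ⊎ hi < π ‼ m
  right {m} j<m m≤n with <-cmp (π ‼ m) (π ‼ i) | distinct away₃ (right-of-i (<-trans i<j j<m)) m≤n j<m (s≤s m≤n)
  ... | tri< πm<πi _ _ | _               = inj₁ πm<πi
  ... | tri≈ _ πm≡πi _ | πm≢πi , _       = ⊥-elim (πm≢πi πm≡πi)
  ... | tri> _ _ πi<πm | _ , _ , πm≢hi   =
    inj₂ (≤∧≢⇒< (≮⇒≥ (no-entry column₃ (right-of-i (<-trans i<j j<m)) m≤n j<m (s≤s m≤n) πi<πm))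
                (≢-sym πm≢hi))

frame⇒boxes : ∀ {π i j lo hi} → Frame (π ‼_) (length π) i j lo hi →
              T (emptyBoxesᵇ π (columns π i (suc i) j) (rows π (π ‼ i ∷ lo ∷ hi ∷ [])))
frame⇒boxes {π} {i} {j} {lo} {hi} F =
  All.all⁻ (emptyBoxᵇ π (columns π i (suc i) j) (rows π (π ‼ i ∷ lo ∷ hi ∷ []))) {xs = R₀}
    (Empty⇒emptyᵇ (empty λ 1≤m _ _ m<i _ πm<πi → <-asym πm<πi (<-trans fi<lo (left 1≤m m<i))) ∷
     Empty⇒emptyᵇ (empty λ 1≤m _ _ m<i _ πm<lo → <-asym πm<lo (left 1≤m m<i)) ∷
     no-column ∷ no-column ∷ no-column ∷ no-column ∷
     Empty⇒emptyᵇ (empty λ _ _ 1+i<m m<j πi<πm _ → <-asym πi<πm (mid 1+i<m m<j)) ∷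
     Empty⇒emptyᵇ (empty λ _ _ 1+i<m m<j lo<πm _ → <-asym (<-trans fi<lo lo<πm) (mid 1+i<m m<j)) ∷
     Empty⇒emptyᵇ (empty λ _ _ 1+i<m m<j hi<πm _ →
                     <-asym (<-trans (<-trans fi<lo lo<hi) hi<πm) (mid 1+i<m m<j)) ∷
     Empty⇒emptyᵇ (empty λ _ m≤n j<m _ πi<πm πm<lo → case right j<m m≤n of λ where
                     (inj₁ πm<πi) → <-asym πm<πi πi<πm
                     (inj₂ hi<πm) → <-asym πm<lo (<-trans lo<hi hi<πm)) ∷
     Empty⇒emptyᵇ (empty λ _ m≤n j<m _ lo<πm πm<hi → case right j<m m≤n of λ where
                     (inj₁ πm<πi) → <-asym πm<πi (<-trans fi<lo lo<πm)
                     (inj₂ hi<πm) → <-asym πm<hi hi<πm) ∷ [])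
  where
  open Frame F
  no-column : ∀ {y y′} → T (emptyᵇ π i (suc i) y y′)
  no-column = Empty⇒emptyᵇ (empty λ _ _ i<m m<1+i _ _ → <-irrefl refl (≤-<-trans (≤-pred m<1+i) i<m))

occurrence⇒site : ∀ {τ n π i k j} → IsPerm n π → 1 ≤ i → i < k → k < j → j ≤ n →
                  T (isOccᵇ (meshOf τ) π (i ∷ k ∷ j ∷ [])) → k ≡ suc i × Site τ (π ‼_) n i j
occurrence⇒site {τ} {n} {π} {i} {k} {j} P 1≤i i<k k<j j≤n h
  with iso , boxes ← Equivalence.to T-∧ (subst T (isOccᵇ-unfold (word τ) π i k j) h) =
  proj₁ k≡1+i×F , site (subst (λ m → Frame (π ‼_) m i j lo hi) length≡ (proj₂ k≡1+i×F))
                       (subst (λ m → Orient τ (π ‼ m) (π ‼ j) lo hi) (proj₁ k≡1+i×F) orient)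
  where
  open IsPerm P
  O : Ordered τ (π ‼ i) (π ‼ k) (π ‼ j)
  O = orderIsoᵇ⇒Ordered τ iso
  open Ordered O
  k≡1+i×F : k ≡ suc i × Frame (π ‼_) (length π) i j lo hi
  k≡1+i×F = boxes⇒frame (subst (λ m → IsPerm m π) (sym length≡) P) 1≤i i<k k<j
                        (subst (j ≤_) (sym length≡) j≤n) O
                        (subst (T ∘ emptyBoxesᵇ π (columns π i k j) ∘ rows π) (Ordered⇒sort O) boxes)

site⇒occurrence : ∀ {τ n π i j} → length π ≡ n → Site τ (π ‼_) n i j →
                  T (isOccᵇ (meshOf τ) π (i ∷ suc i ∷ j ∷ []))
site⇒occurrence {τ} {n} {π} {i} {j} |π|≡n S =
  subst T (sym (isOccᵇ-unfold (word τ) π i (suc i) j))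
    (Equivalence.from T-∧
      (Ordered⇒orderIsoᵇ O ,
       subst (T ∘ emptyBoxesᵇ π (columns π i (suc i) j) ∘ rows π) (sym (Ordered⇒sort O))
             (frame⇒boxes (subst (λ m → Frame (π ‼_) m i j _ _) (sym |π|≡n) (Site.frame S)))))
  where
  O : Ordered τ (π ‼ i) (π ‼ suc i) (π ‼ j)
  O = ordered (Site.fi<lo S) (Site.lo<hi S) (Site.orient S)

-- Counting occurrences

∈-choose⁻ : ∀ k {xs ys} → AllPairs _<_ xs → ys ∈ choose k xs → length ys ≡ k × All (_∈ xs) ys × AllPairs _<_ ys
∈-choose⁻ zero    _                  (here refl) = refl , [] , []
∈-choose⁻ (suc k) {x ∷ xs} (x<xs ∷ xs<) ys∈ with ∈-++⁻ (map (x ∷_) (choose k xs)) ys∈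
... | inj₁ ys∈map with zs , zs∈ , refl ← ∈-map⁻ (x ∷_) ys∈map
                  with |zs| , zs⊆xs , zs< ← ∈-choose⁻ k xs< zs∈ =
  cong suc |zs| , here refl ∷ All.map there zs⊆xs , All.map (All.lookup x<xs) zs⊆xs ∷ zs<
... | inj₂ ys∈rest with |ys| , ys⊆xs , ys< ← ∈-choose⁻ (suc k) xs< ys∈rest =
  |ys| , All.map there ys⊆xs , ys<

∈-choose⁺ : ∀ {xs ys} → AllPairs _<_ xs → AllPairs _<_ ys → All (_∈ xs) ys → ys ∈ choose (length ys) xs
∈-choose⁺ {[]}     {[]}     _ _ _ = here refl
∈-choose⁺ {x ∷ xs} {[]}     _ _ _ = here refl
∈-choose⁺ {[]}     {y ∷ ys} _ _ (() ∷ _)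
∈-choose⁺ {x ∷ xs} {y ∷ ys} (x<xs ∷ xs<) (y<ys ∷ ys<) (here refl ∷ ys⊆) =
  ∈-++⁺ˡ (∈-map⁺ (x ∷_) (∈-choose⁺ xs< ys< (All.zipWith tail (y<ys , ys⊆))))
  where
  tail : ∀ {z} → x < z × z ∈ x ∷ xs → z ∈ xs
  tail (x<x , here refl) = ⊥-elim (<-irrefl refl x<x)
  tail (_   , there z∈)  = z∈
∈-choose⁺ {x ∷ xs} {y ∷ ys} (x<xs ∷ xs<) (y<ys ∷ ys<) (there y∈ ∷ ys⊆) =
  ∈-++⁺ʳ (map (x ∷_) (choose (length ys) xs))
         (∈-choose⁺ xs< (y<ys ∷ ys<) (y∈ ∷ All.zipWith tail (y<ys , ys⊆)))
  where
  tail : ∀ {z} → y < z × z ∈ x ∷ xs → z ∈ xs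
  tail (y<x , here refl) = ⊥-elim (<-irrefl refl (<-trans (All.lookup x<xs y∈) y<x))
  tail (_   , there z∈)  = z∈

choose-unique : ∀ k {xs} → AllPairs _<_ xs → Unique (choose k xs)
choose-unique zero    _ = [] ∷ []
choose-unique (suc k) {[]}     _ = []
choose-unique (suc k) {x ∷ xs} (x<xs ∷ xs<) =
  Unique.++⁺ (Unique.map⁺ ∷-injectiveʳ (choose-unique k xs<)) (choose-unique (suc k) xs<) disjoint
  where
  disjoint : ∀ {ys} → ¬ (ys ∈ map (x ∷_) (choose k xs) × ys ∈ choose (suc k) xs)
  disjoint (ys∈map , ys∈rest) with _ , _ , refl ← ∈-map⁻ (x ∷_) ys∈map
                              with _ , x∈xs ∷ _ , _ ← ∈-choose⁻ (suc k) xs< ys∈rest =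
    <-irrefl refl (All.lookup x<xs x∈xs)

∈-choose3⁻ : ∀ {N t} → t ∈ choose 3 (range1 N) →
             ∃[ i ] ∃[ k ] ∃[ j ] (t ≡ i ∷ k ∷ j ∷ [] × 1 ≤ i × i < k × k < j × j ≤ N)
∈-choose3⁻ {N} t∈ with ∈-choose⁻ 3 (range1-increasing N) t∈
... | _ , i∈ ∷ _ ∷ j∈ ∷ [] , (i<k ∷ _) ∷ (k<j ∷ []) ∷ _ =
  _ , _ , _ , refl , proj₁ (∈-range1⁻ i∈) , i<k , k<j , proj₂ (∈-range1⁻ j∈)

partnerOf : List ℕ → ℕ → ℕ
partnerOf π i = partner (π ‼_) (length π) i

-- Opaque, as is step below: unfolding isOccᵇ at concrete positions makes type checking explode.
opaque
  siteᵇ : Pattern → List ℕ → ℕ → Bool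
  siteᵇ τ π i = (suc i <ᵇ partnerOf π i) ∧
                ((partnerOf π i ≤ᵇ length π) ∧ isOccᵇ (meshOf τ) π (i ∷ suc i ∷ partnerOf π i ∷ []))

HasSite : Pattern → ℕ → List ℕ → ℕ → Set
HasSite τ n π i = ∃[ j ] Site τ (π ‼_) n i j

module _ {n π} (P : IsPerm n π) where
  open IsPerm P

  site-partnerOf : ∀ {τ i j} → Site τ (π ‼_) n i j → j ≡ partnerOf π i
  site-partnerOf S = trans (site-partner S) (cong (λ m → partner (π ‼_) m _) (sym length≡))

  opaque
    unfolding siteᵇ

    siteᵇ⇒Site : ∀ {τ i} → 1 ≤ i → T (siteᵇ τ π i) → Site τ (π ‼_) n i (partnerOf π i)
    siteᵇ⇒Site {τ} {i} 1≤i t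
      with 1+i<j , rest ← Equivalence.to (T-∧ {suc i <ᵇ partnerOf π i}) t
      with j≤|π| , occurs ← Equivalence.to (T-∧ {partnerOf π i ≤ᵇ length π}) rest =
      proj₂ (occurrence⇒site {τ} P 1≤i (n<1+n i) (<ᵇ⇒< _ _ 1+i<j)
                             (subst (_ ≤_) length≡ (≤ᵇ⇒≤ _ _ j≤|π|)) occurs)

    Site⇒siteᵇ : ∀ {τ i j} → Site τ (π ‼_) n i j → T (siteᵇ τ π i)
    Site⇒siteᵇ {τ} {i} S with refl ← site-partnerOf S =
      Equivalence.from (T-∧ {suc i <ᵇ partnerOf π i}) (<⇒<ᵇ 1+i<j ,
        Equivalence.from (T-∧ {partnerOf π i ≤ᵇ length π})
          (≤⇒≤ᵇ (subst (_ ≤_) (sym length≡) j≤n) , site⇒occurrence {π = π} length≡ S))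
      where open Site S

  siteᵇ⇔HasSite : ∀ {τ i} → 1 ≤ i → T (siteᵇ τ π i) ⇔ HasSite τ n π i
  siteᵇ⇔HasSite 1≤i = mk⇔ (λ t → _ , siteᵇ⇒Site 1≤i t) (λ (_ , S) → Site⇒siteᵇ S)

  occurrences≡sites : ∀ τ → length (filterᵇ (isOccᵇ (meshOf τ) π) (choose 3 (range1 (length π)))) ≡
                            length (filterᵇ (siteᵇ τ π) (range1 (length π)))
  occurrences≡sites τ = trans (unique-length occurrences! triples! (mk⇔ to from)) (length-map triple sites)
    where
    N : ℕ
    N = length π
    occurrences : List (List ℕ)
    occurrences = filterᵇ (isOccᵇ (meshOf τ) π) (choose 3 (range1 N))
    sites : List ℕ
    sites = filterᵇ (siteᵇ τ π) (range1 N)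

    triple : ℕ → List ℕ
    triple i = i ∷ suc i ∷ partnerOf π i ∷ []

    occurrences! : Unique occurrences
    occurrences! = filterᵇ-unique (isOccᵇ (meshOf τ) π) (choose-unique 3 (range1-increasing N))

    triples! : Unique (map triple sites)
    triples! = map-unique triple (λ _ _ → ∷-injectiveˡ) (filterᵇ-unique (siteᵇ τ π) (range1-unique N))

    ≤N⇒≤n : ∀ {m} → m ≤ N → m ≤ n
    ≤N⇒≤n = subst (_ ≤_) length≡

    to : ∀ {t} → t ∈ occurrences → t ∈ map triple sites
    to t∈
      with t∈choose , occurs ← ∈-filter⁻ (T? ∘ isOccᵇ (meshOf τ) π) {xs = choose 3 (range1 N)} t∈
      with i , k , j , refl , 1≤i , i<k , k<j , j≤N ← ∈-choose3⁻ {N} t∈choose =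
      subst (_∈ map triple sites)
            (sym (cong₂ (λ k j → i ∷ k ∷ j ∷ []) (proj₁ k≡1+i×S) (site-partnerOf (proj₂ k≡1+i×S))))
            (∈-map⁺ triple (∈-filter⁺ (T? ∘ siteᵇ τ π)
                                      (∈-range1⁺ 1≤i (≤-trans (<⇒≤ (<-trans i<k k<j)) j≤N))
                                      (Site⇒siteᵇ (proj₂ k≡1+i×S))))
      where
      k≡1+i×S : k ≡ suc i × Site τ (π ‼_) n i j
      k≡1+i×S = occurrence⇒site {τ} P 1≤i i<k k<j (≤N⇒≤n j≤N) occurs

    from : ∀ {t} → t ∈ map triple sites → t ∈ occurrences
    from t∈ with i , i∈sites , refl ← ∈-map⁻ triple t∈
            with i∈ , site-at-i ← ∈-filter⁻ (T? ∘ siteᵇ τ π) {xs = range1 N} i∈sites =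
      ∈-filter⁺ (T? ∘ isOccᵇ (meshOf τ) π)
        (∈-choose⁺ (range1-increasing N) ((n<1+n i ∷ i<j ∷ []) ∷ (1+i<j ∷ []) ∷ [] ∷ [])
                   (i∈ ∷ ∈-range1⁺ (s≤s z≤n) (≤-trans (<⇒≤ 1+i<j) j≤N)
                       ∷ ∈-range1⁺ (≤-trans 1≤i (<⇒≤ i<j)) j≤N ∷ []))
        (site⇒occurrence {τ} {π = π} length≡ site-i)
      where
      1≤i : 1 ≤ i
      1≤i = proj₁ (∈-range1⁻ i∈)
      site-i : Site τ (π ‼_) n i (partnerOf π i)
      site-i = siteᵇ⇒Site {τ} 1≤i site-at-i
      open Site site-i using (1+i<j; j≤n)
      i<j : i < partnerOf π i
      i<j = <-trans (n<1+n i) 1+i<j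
      j≤N : partnerOf π i ≤ N
      j≤N = subst (_ ≤_) (sym length≡) j≤n

-- Flipping every site

opaque
  step : ℕ → List ℕ → List ℕ
  step i π = if siteᵇ p123 π i ∨ siteᵇ p132 π i then swap π (suc i) (partnerOf π i) else π

data StepView (n : ℕ) (π : List ℕ) (i : ℕ) : Set where
  no-site : (∀ {τ} → ¬ HasSite τ n π i) → step i π ≡ π → StepView n π i
  at-site : ∀ {τ j} → Site τ (π ‼_) n i j → step i π ≡ swap π (suc i) j → StepView n π i

opaque
  unfolding step

  stepView : ∀ {n π i} → IsPerm n π → 1 ≤ i → StepView n π i
  stepView {n} {π} {i} P 1≤i = view (siteᵇ p123 π i) (siteᵇ p132 π i) refl refl
    where
    chosen : ∀ {b c} → siteᵇ p123 π i ≡ b → siteᵇ p132 π i ≡ c →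
             step i π ≡ (if b ∨ c then swap π (suc i) (partnerOf π i) else π)
    chosen = cong₂ (λ b c → if b ∨ c then swap π (suc i) (partnerOf π i) else π)

    view : ∀ b c → siteᵇ p123 π i ≡ b → siteᵇ p132 π i ≡ c → StepView n π i
    view true  _     site123 site132 = at-site (siteᵇ⇒Site P {p123} 1≤i (subst T (sym site123) _)) (chosen site123 site132)
    view false true  site123 site132 = at-site (siteᵇ⇒Site P {p132} 1≤i (subst T (sym site132) _)) (chosen site123 site132)
    view false false site123 site132 = no-site none (chosen site123 site132)
      where
      none : ∀ {τ} → ¬ HasSite τ n π i
      none {p123} (_ , S) = subst T site123 (Site⇒siteᵇ P S)
      none {p132} (_ , S) = subst T site132 (Site⇒siteᵇ P S)

module _ {n π i} (P : IsPerm n π) (1≤i : 1 ≤ i) where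
  open IsPerm P

  private
    module AtSite {τ j} (S : Site τ (π ‼_) n i j) where
      open Site S using (1+i<j; j≤n)
      swapped : Swapped (π ‼_) (swap π (suc i) j ‼_) (suc i) j
      swapped = swap-Swapped π (s≤s z≤n) 1+i<j (subst (j ≤_) (sym length≡) j≤n)
      swapped-IsPerm : IsPerm n (swap π (suc i) j)
      swapped-IsPerm = IsPerm-swap P (s≤s z≤n) 1+i<j j≤n
      swapped-site : Site (opposite τ) (swap π (suc i) j ‼_) n i j
      swapped-site = site-opposite S swapped

  step-IsPerm : IsPerm n (step i π)
  step-IsPerm with stepView P 1≤i
  ... | no-site _ step≡ = subst (IsPerm n) (sym step≡) P
  ... | at-site S step≡ = subst (IsPerm n) (sym step≡) (AtSite.swapped-IsPerm S)

  step-involutive : step i (step i π) ≡ π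
  step-involutive with stepView P 1≤i
  ... | no-site _ step≡ = trans (cong (step i) step≡) step≡
  ... | at-site S step≡ with stepView (AtSite.swapped-IsPerm S) 1≤i
  ...   | no-site none _ = ⊥-elim (none (_ , AtSite.swapped-site S))
  ...   | at-site S′ step′≡ with refl ← site-partner-unique (AtSite.swapped-site S) S′ =
    trans (cong (step i) step≡)
          (trans step′≡ (swap-involutive π (s≤s z≤n) 1+i<j (subst (_ ≤_) (sym length≡) j≤n)))
    where open Site S using (1+i<j; j≤n)

  step-flips : ∀ {τ} → HasSite (opposite τ) n (step i π) i ⇔ HasSite τ n π i
  step-flips with stepView P 1≤i
  ... | no-site none step≡ rewrite step≡ = mk⇔ (⊥-elim ∘ none) (⊥-elim ∘ none)
  ... | at-site {j = j} S step≡ rewrite step≡ = mk⇔ to from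
    where
    open AtSite S
    to : ∀ {τ} → HasSite (opposite τ) n (swap π (suc i) j) i → HasSite τ n π i
    to (_ , S′) with refl ← opposite-injective (site-pattern-unique S′ swapped-site) = _ , S
    from : ∀ {τ} → HasSite τ n π i → HasSite (opposite τ) n (swap π (suc i) j) i
    from (_ , S′) with refl ← site-pattern-unique S′ S = _ , swapped-site

  step-preserves : ∀ {τ i′} → i′ ≢ i → HasSite τ n (step i π) i′ ⇔ HasSite τ n π i′
  step-preserves i′≢i with stepView P 1≤i
  ... | no-site _ step≡ rewrite step≡ = mk⇔ (λ h → h) (λ h → h)
  ... | at-site S step≡ rewrite step≡ =
    mk⇔ (λ (_ , S′) → site-survives-swap swapped-site (Swapped-sym swapped) S′ i′≢i)
        (λ (_ , S′) → site-survives-swap S swapped S′ i′≢i)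
    where open AtSite S

flipAll : ℕ → List ℕ → List ℕ
flipAll zero    π = π
flipAll (suc k) π = step (suc k) (flipAll k π)

unflipAll : ℕ → List ℕ → List ℕ
unflipAll zero    π = π
unflipAll (suc k) π = unflipAll k (step (suc k) π)

module _ {n : ℕ} where

  flipAll-IsPerm : ∀ k {π} → IsPerm n π → IsPerm n (flipAll k π)
  flipAll-IsPerm zero    P = P
  flipAll-IsPerm (suc k) P = step-IsPerm (flipAll-IsPerm k P) (s≤s z≤n)

  unflipAll-IsPerm : ∀ k {π} → IsPerm n π → IsPerm n (unflipAll k π)
  unflipAll-IsPerm zero    P = P
  unflipAll-IsPerm (suc k) P = unflipAll-IsPerm k (step-IsPerm P (s≤s z≤n))

  unflipAll-flipAll : ∀ k {π} → IsPerm n π → unflipAll k (flipAll k π) ≡ π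
  unflipAll-flipAll zero    P = refl
  unflipAll-flipAll (suc k) P =
    trans (cong (unflipAll k) (step-involutive (flipAll-IsPerm k P) (s≤s z≤n))) (unflipAll-flipAll k P)

  flipAll-unflipAll : ∀ k {π} → IsPerm n π → flipAll k (unflipAll k π) ≡ π
  flipAll-unflipAll zero    P = refl
  flipAll-unflipAll (suc k) P =
    trans (cong (step (suc k)) (flipAll-unflipAll k (step-IsPerm P (s≤s z≤n)))) (step-involutive P (s≤s z≤n))

  flipAll-beyond : ∀ k {τ π i} → IsPerm n π → k < i → HasSite τ n (flipAll k π) i ⇔ HasSite τ n π i
  flipAll-beyond zero    P _   = mk⇔ (λ h → h) (λ h → h)
  flipAll-beyond (suc k) P k<i =
    ⇔.trans (step-preserves (flipAll-IsPerm k P) (s≤s z≤n) (>⇒≢ k<i)) (flipAll-beyond k P (<-trans (n<1+n k) k<i))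

  flipAll-flips : ∀ k {τ π i} → IsPerm n π → 1 ≤ i → i ≤ k →
                  HasSite (opposite τ) n (flipAll k π) i ⇔ HasSite τ n π i
  flipAll-flips zero    _ (s≤s _) ()
  flipAll-flips (suc k) P 1≤i i≤1+k with m≤n⇒m<n∨m≡n i≤1+k
  ... | inj₂ refl = ⇔.trans (step-flips (flipAll-IsPerm k P) 1≤i) (flipAll-beyond k P (n<1+n k))
  ... | inj₁ i<1+k =
    ⇔.trans (step-preserves (flipAll-IsPerm k P) (s≤s z≤n) (<⇒≢ i<1+k)) (flipAll-flips k P 1≤i (≤-pred i<1+k))

siteCount : Pattern → ℕ → List ℕ → ℕ
siteCount τ n π = length (filterᵇ (siteᵇ τ π) (range1 n))

-- Splitting on τ lets length (word τ), the size of the subsets occ ranges over, reduce to 3.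
occ≡siteCount : ∀ τ {n π} → IsPerm n π → occ (meshOf τ) π ≡ siteCount τ n π
occ≡siteCount p123 {π = π} P = trans (occurrences≡sites P p123) (cong (λ m → siteCount p123 m π) (IsPerm.length≡ P))
occ≡siteCount p132 {π = π} P = trans (occurrences≡sites P p132) (cong (λ m → siteCount p132 m π) (IsPerm.length≡ P))

siteCount-flipAll : ∀ τ {n π} → IsPerm n π → siteCount (opposite τ) n (flipAll n π) ≡ siteCount τ n π
siteCount-flipAll τ {n} {π} P = length-filterᵇ-cong (siteᵇ (opposite τ) (flipAll n π)) (siteᵇ τ π) sites⇔
  where
  sites⇔ : ∀ {i} → i ∈ range1 n → T (siteᵇ (opposite τ) (flipAll n π) i) ⇔ T (siteᵇ τ π i)
  sites⇔ i∈ with 1≤i , i≤n ← ∈-range1⁻ i∈ =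
    ⇔.trans (siteᵇ⇔HasSite (flipAll-IsPerm n P) 1≤i)
            (⇔.trans (flipAll-flips n P 1≤i i≤n) (⇔.sym (siteᵇ⇔HasSite P 1≤i)))

occ-flipAll : ∀ τ {n π} → IsPerm n π → occ (meshOf (opposite τ)) (flipAll n π) ≡ occ (meshOf τ) π
occ-flipAll τ {n} P = trans (occ≡siteCount (opposite τ) (flipAll-IsPerm n P))
                            (trans (siteCount-flipAll τ P) (sym (occ≡siteCount τ P)))

theorem2p1 : mesh (1 ∷ 2 ∷ 3 ∷ []) R₀ ∼d mesh (1 ∷ 3 ∷ 2 ∷ []) R₀
theorem2p1 n ℓ =
  length-filterᵇ-bijection (λ π → occ (meshOf p123) π ≡ᵇ ℓ) (λ π → occ (meshOf p132) π ≡ᵇ ℓ) (S-unique n)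
    (∈S⁺ ∘ flipAll-IsPerm n ∘ ∈S⁻ n) (∈S⁺ ∘ unflipAll-IsPerm n ∘ ∈S⁻ n)
    (unflipAll-flipAll n ∘ ∈S⁻ n) (flipAll-unflipAll n ∘ ∈S⁻ n)
    (cong (_≡ᵇ ℓ) ∘ occ-flipAll p123 ∘ ∈S⁻ n)
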